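{- Let $k,q\ge 1$. For every graph $G$ the following are equivalent: (1) $G$ has a $k$-construction tree of elimination depth at most $q$; (2) $G$ has a tree-decomposition of width at most $k-1$ and depth at most $q$; (3) $G$ admits a $k$-pebble forest cover of depth at most $q$.
   Context: All graphs are finite, simple and loopless. A $k$-labelled graph is a graph $G$ with a partial injective-free labelling $\nu_G\colon\{1,\dots,k\}\rightharpoonup V(G)$ (each label on at most one vertex, a vertex may carry several labels, not all labels need be used); it is fully labelled if every vertex carries a label; an unlabelled graph is a $k$-labelled graph with no labels. Removing a label $\ell$ makes $\nu(\ell)$ undefined. The product of two $k$-labelled graphs is obtained from their disjoint union by identifying vertices carrying the same label and suppressing parallel edges. A $k$-construction tree for $G$ is a rooted tree $(T,r)$ with a map $\lambda$ from $V(T)$ to $k$-labelled graphs such that: $\lambda(r)=G$; every leaf is assigned a fully labelled graph; every internal node $t$ with exactly one child $t'$ (an elimination node) has $\lambda(t)$ obtained from $\lambda(t')$ by removing one label; every internal node with more than one child has $\lambda(t)$ equal to the product of the graphs of its children. Its elimination depth is the maximum number of elimination nodes on a root-to-leaf path. A tree-decomposition $(T,\beta)$ of $G$ is a tree $T$ and bags $\beta(t)\subseteq V(G)$ with $\bigcup_t G[\beta(t)]=G$ and, for every vertex $v$, $\{t: v\in\beta(t)\}$ inducing a connected subtree; width is $\max_t|\beta(t)|-1$; depth is $\min_{r\in V(T)}\max_{v\in V(T)}\left|\bigcup_{t\preceq v}\beta(t)\right|$, where $\preceq$ is the ancestor order of $T$ rooted at $r$. A $k$-pebble forest cover of $G$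 is a rooted forest $(F,\vec r)$ on $V(G)$ with induced ancestor order $\preceq$ and a map $p\colon V(G)\to\{1,\dots,k\}$ such that for every edge $uv$, $u\preceq v$ or $v\preceq u$, and if $uv\in E(G)$, $u\prec v$, then $p(u)\ne p(w)$ for all $w$ with $u\prec w\preceq v$; its depth is the maximum number of vertices on a root-to-leaf path. -}

module Defs where

open import Data.Nat using (ℕ; zero; suc; _≤_; _⊔_)
open import Data.Fin using (Fin)
import Data.Fin as Fin
open import Data.Fin.Subset using (Subset; ∣_∣) renaming (_∈_ to _∈ₛ_)
open import Data.Bool using (Bool; true; false)
open import Data.Maybe using (Maybe; just; nothing)
import Data.Maybe as Maybe
open import Data.List using (List; []; _∷_; length)
open import Data.List.Membership.Propositional using () renaming (_∈_ to _∈ₗ_)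
open import Data.List.Relation.Unary.All using (All)
open import Data.List.Relation.Unary.Unique.Propositional using (Unique)
open import Data.Product using (Σ; ∃; ∃₂; _×_; _,_)
open import Data.Sum using (_⊎_)
open import Relation.Binary.PropositionalEquality using (_≡_; _≢_)
open import Relation.Binary.Construct.Closure.Equivalence using (EqClosure)
open import Function.Bundles using (_⇔_)

record Graph : Set where
  field
    n     : ℕ
    adj   : Fin n → Fin n → Bool
    sym   : ∀ u v → adj u v ≡ adj v u
    irrefl : ∀ u → adj u u ≡ false

V : Graph → Set
V G = Fin (Graph.n G)

E : (G : Graph) → V G → V G → Set
E G u v = Graph.adj G u v ≡ true

data Walk (G : Graph) : V G → V G → Set where
  []  : ∀ {u} → Walk G u u
  _∷_ : ∀ {u w v} → E G u w → Walk G w v → Walk G u v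

verts : ∀ {G u v} → Walk G u v → List (V G)
verts {u = u} []      = u ∷ []
verts {u = u} (_ ∷ p) = u ∷ verts p

Connected : Graph → Set
Connected G = ∀ a b → Walk G a b

ConnectedSet : (G : Graph) → (V G → Set) → Set
ConnectedSet G P = ∀ a b → P a → P b → Σ (Walk G a b) λ w → All P (verts w)

-- no cycle: a path w ... u together with an edge u w has at most 2 vertices
Acyclic : Graph → Set
Acyclic G = ∀ u w → E G u w → (p : Walk G w u) → Unique (verts p) → length (verts p) ≤ 2

IsTree : Graph → Set
IsTree G = Connected G × Acyclic G

Ancestor : (T : Graph) → (r t v : V T) → Set
Ancestor T r t v = Σ (Walk T r v) λ p → Unique (verts p) × t ∈ₗ verts p

record LGraph (k : ℕ) : Set where
  field
    graph : Graph
    label : Fin k → Maybe (V graph)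

open LGraph public

LV : ∀ {k} → LGraph k → Set
LV H = V (graph H)

LE : ∀ {k} (H : LGraph k) → LV H → LV H → Set
LE H = E (graph H)

unlabelled : ∀ {k} → Graph → LGraph k
unlabelled G = record { graph = G ; label = λ _ → nothing }

FullyLabelled : ∀ {k} → LGraph k → Set
FullyLabelled H = ∀ v → ∃ λ ℓ → label H ℓ ≡ just v

RemoveLabel : ∀ {k} → Fin k → LGraph k → LGraph k → Set
RemoveLabel ℓ H' H =
  Σ (LV H' → LV H) λ f → Σ (LV H → LV H') λ g →
    (∀ x → g (f x) ≡ x) × (∀ y → f (g y) ≡ y) ×
    (∀ u v → Graph.adj (graph H) (f u) (f v) ≡ Graph.adj (graph H') u v) ×
    (label H ℓ ≡ nothing) ×
    (∀ ℓ' → ℓ' ≢ ℓ → label H ℓ' ≡ Maybe.map f (label H' ℓ'))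

-- H is (isomorphic to) the product of the family Gs: the disjoint union
-- with vertices carrying the same label identified (equivalence closure),
-- parallel edges suppressed.  f i embeds the vertices of Gs i into H.
ShareLabel : ∀ {k m} (Gs : Fin m → LGraph k) →
  Σ (Fin m) (λ i → LV (Gs i)) → Σ (Fin m) (λ i → LV (Gs i)) → Set
ShareLabel Gs (i , u) (j , w) = ∃ λ ℓ → label (Gs i) ℓ ≡ just u × label (Gs j) ℓ ≡ just w

IsProduct : ∀ {k m} → (Fin m → LGraph k) → LGraph k → Set
IsProduct {k} {m} Gs H =
  Σ ((i : Fin m) → LV (Gs i) → LV H) λ f →
    (∀ a → ∃₂ λ i u → f i u ≡ a) ×
    (∀ i u j w → (f i u ≡ f j w) ⇔ EqClosure (ShareLabel Gs) (i , u) (j , w)) ×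
    (∀ a b → LE H a b ⇔ (∃ λ i → ∃₂ λ u v → LE (Gs i) u v × f i u ≡ a × f i v ≡ b)) ×
    (∀ ℓ a → label H ℓ ≡ just a ⇔ (∃₂ λ i u → label (Gs i) ℓ ≡ just u × f i u ≡ a))

data CTree (k : ℕ) : LGraph k → Set where
  leaf : ∀ {H} → FullyLabelled H → CTree k H
  elim : ∀ {H} (H' : LGraph k) (ℓ : Fin k) → CTree k H' → RemoveLabel ℓ H' H → CTree k H
  prod : ∀ {H} (m : ℕ) → 2 ≤ m → (Gs : Fin m → LGraph k) →
         ((i : Fin m) → CTree k (Gs i)) → IsProduct Gs H → CTree k H

maxF : (m : ℕ) → (Fin m → ℕ) → ℕ
maxF zero    f = 0
maxF (suc m) f = f Fin.zero ⊔ maxF m (λ i → f (Fin.suc i))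

elimDepth : ∀ {k H} → CTree k H → ℕ
elimDepth (leaf _)            = 0
elimDepth (elim _ _ t _)      = suc (elimDepth t)
elimDepth (prod m _ _ ts _)   = maxF m (λ i → elimDepth (ts i))

HasConstructionTree : (k q : ℕ) → Graph → Set
HasConstructionTree k q G = Σ (CTree k (unlabelled G)) λ T → elimDepth T ≤ q

record TreeDecomposition (G : Graph) : Set where
  field
    T      : Graph
    isTree : IsTree T
    bag    : V T → Subset (Graph.n G)
    vertexCover : ∀ x → ∃ λ t → x ∈ₛ bag t
    edgeCover   : ∀ x y → E G x y → ∃ λ t → x ∈ₛ bag t × y ∈ₛ bag t
    connectedBags : ∀ x → ConnectedSet T (λ t → x ∈ₛ bag t)

-- width ≤ w  (i.e. max |β(t)| - 1 ≤ w)
WidthAtMost : ∀ {G} → TreeDecomposition G → ℕ → Set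
WidthAtMost D w = ∀ t → ∣ TreeDecomposition.bag D t ∣ ≤ suc w

-- depth ≤ q: some root r such that for every node v the union of the bags
-- of the ancestors of v has at most q elements (is contained in a set of size ≤ q)
DepthAtMost : ∀ {G} → TreeDecomposition G → ℕ → Set
DepthAtMost {G} D q =
  ∃ λ (r : V T) → ∀ v → ∃ λ (U : Subset (Graph.n G)) →
    ∣ U ∣ ≤ q × (∀ t x → Ancestor T r t v → x ∈ₛ bag t → x ∈ₛ U)
  where open TreeDecomposition D

HasTreeDecomposition : (k q : ℕ) → Graph → Set
HasTreeDecomposition k q G =
  Σ (TreeDecomposition G) λ D → WidthAtMost D (k Data.Nat.∸ 1) × DepthAtMost D q

data Anc {n : ℕ} (par : Fin n → Maybe (Fin n)) : Fin n → Fin n → Set where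
  here : ∀ {v} → Anc par v v
  up   : ∀ {u v w} → par v ≡ just w → Anc par u w → Anc par u v

-- the root-to-v path has m vertices
data RootDist {n : ℕ} (par : Fin n → Maybe (Fin n)) : Fin n → ℕ → Set where
  root : ∀ {v} → par v ≡ nothing → RootDist par v 1
  step : ∀ {v w m} → par v ≡ just w → RootDist par w m → RootDist par v (suc m)

record PebbleForestCover (k : ℕ) (G : Graph) : Set where
  field
    parent : V G → Maybe (V G)
    pebble : V G → Fin k
    isForest : ∀ v → ∃ λ m → RootDist parent v m
    edgeAnc  : ∀ u v → E G u v → Anc parent u v ⊎ Anc parent v u
    pebbling : ∀ u v w → E G u v → Anc parent u v → u ≢ v →
               Anc parent u w → u ≢ w → Anc parent w v → pebble u ≢ pebble w

ForestDepthAtMost : ∀ {k G} → PebbleForestCover k G → ℕ → Set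
ForestDepthAtMost P q = ∀ v m → RootDist (PebbleForestCover.parent P) v m → m ≤ q

HasPebbleForestCover : (k q : ℕ) → Graph → Set
HasPebbleForestCover k q G = Σ (PebbleForestCover k G) λ P → ForestDepthAtMost P q

-- All three conditions are equivalent to a fourth: a rooted forest on V(G) of depth at most q,
-- in which every edge joins an ancestor to a descendant and the boundary of every vertex v
-- (v and its ancestors adjacent to the subtree of v) has at most k elements.
-- Adding a common root and using the boundaries as bags turns it into a tree decomposition;
-- conversely, ordering the vertices of a tree decomposition by the shallowest node containing
-- them recovers such a forest. Pebbling greedily from the roots down gives a pebble forest cover,
-- as the boundary of v without v has fewer than k vertices. Along a construction tree the
-- unlabelled vertices carry such a forest: a vertex losing its last label becomes a root above
-- the forest built so far, and the labels at that moment cover its boundary. Conversely, a pebble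
-- forest cover yields a construction tree with one elimination per vertex, labelling boundaries
-- by their pebbles.

module Submission where

open import Defs
open import Data.Nat using (ℕ; _≤_)
open import Data.Product using (_×_)
open import Function.Bundles using (_⇔_)

open import Axiom.UniquenessOfIdentityProofs using (module Decidable⇒UIP)
open import Data.Bool using (Bool; true; false; _∨_; if_then_else_)
import Data.Bool.Properties as Boolₚ
open import Data.Empty using (⊥; ⊥-elim)
open import Data.Fin as Fin using (Fin; zero; suc; toℕ; punchOut)
open import Data.Fin.Properties
  using (suc-injective; toℕ-injective; toℕ<n; injective⇒≤; punchOut-injective; any?; all?; ¬∀⟶∃¬)
open import Data.Fin.Subset using (Subset; ∣_∣) renaming (_∈_ to _∈ₛ_; ⊥ to ∅)
open import Data.Fin.Subset.Properties using (∣⊥∣≡0) renaming (∉⊥ to ∉∅)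
import Data.Fin.Subset.Properties as Subsetₚ
open import Data.List using (List; []; _∷_; _++_; _∷ʳ_; length; map; lookup; allFin; filter)
open import Data.List.Extrema.Nat
  using (argmin; argmax; argmin-all; argmax-all; f[argmin]≤f[xs]; f[xs]≤f[argmax]; f[⊥]≤f[argmax])
open import Data.List.Membership.Propositional using (_∈_; _∉_)
open import Data.List.Membership.Propositional.Properties using (∈-lookup; ∈-map⁺; ∈-map⁻; ∈-allFin)
import Data.List.Membership.Propositional.Properties as Membershipₚ
import Data.List.Membership.Setoid.Properties as Membershipₛ
open import Data.List.Properties using (length-map)
import Data.List.Properties as Listₚ
open import Data.List.Relation.Unary.All using (All; []; _∷_)
import Data.List.Relation.Unary.All as All
import Data.List.Relation.Unary.All.Properties as Allₚ
open import Data.List.Relation.Unary.AllPairs using ([]; _∷_)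
open import Data.List.Relation.Unary.Any using (here; there)
import Data.List.Relation.Unary.Any as Any
import Data.List.Relation.Unary.Any.Properties as Anyₚ
open import Data.List.Relation.Unary.Unique.Propositional using (Unique)
import Data.List.Relation.Unary.Unique.Propositional.Properties as Uniqueₚ
open import Data.Maybe using (Maybe; just; nothing)
import Data.Maybe as Maybe
import Data.Maybe.Properties as Maybeₚ
open import Data.Nat using (zero; suc; _+_; _*_; _<_; z≤n; s≤s; _∸_)
import Data.Nat as ℕ
open import Data.Nat.Induction using (<-wellFounded)
import Data.Nat.Properties as ℕₚ
open import Data.Product using (Σ; ∃; ∃₂; _,_; proj₁; proj₂)
import Data.Product as Product
open import Data.Sum using (_⊎_; inj₁; inj₂)
import Data.Sum as Sum
open import Data.Unit using (⊤; tt)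
open import Data.Vec using ([]; _∷_; here; there)
import Data.Vec as Vec
import Data.Vec.Properties as Vecₚ
open import Data.Vec.Functional using (updateAt)
open import Data.Vec.Functional.Properties using (updateAt-updates; updateAt-minimal)
open import Function.Base using (id; _∘_; case_of_)
open import Function.Bundles using (Equivalence; mk⇔)
open import Induction.WellFounded using (Acc; acc)
open import Relation.Binary.Construct.Closure.Equivalence using (EqClosure)
open import Relation.Binary.Construct.Closure.ReflexiveTransitive using (Star; ε; _◅_)
open import Relation.Binary.Construct.Closure.Symmetric using (SymClosure; fwd; bwd)
open import Relation.Binary.PropositionalEquality
  using (_≡_; _≢_; refl; sym; trans; cong; cong₂; subst; subst₂; setoid; module ≡-Reasoning)
open import Relation.Nullary using (¬_; Dec; yes; no; does; ¬?; _×-dec_; _⊎-dec_; _→-dec_)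
open import Relation.Nullary.Decidable using (dec-true; dec-false; decidable-stable; does-⇔)
open import Relation.Unary using (Decidable)

lookup-injective : ∀ {A : Set} {xs : List A} → Unique xs →
                   ∀ {i j} → lookup xs i ≡ lookup xs j → i ≡ j
lookup-injective {xs = _ ∷ _} _ {zero} {zero} _ = refl
lookup-injective {xs = _ ∷ _} (x∉ ∷ _) {zero} {suc j} e = ⊥-elim (All.lookup x∉ (∈-lookup j) e)
lookup-injective {xs = _ ∷ _} (x∉ ∷ _) {suc i} {zero} e = ⊥-elim (All.lookup x∉ (∈-lookup i) (sym e))
lookup-injective {xs = _ ∷ _} (_ ∷ u) {suc i} {suc j} e = cong suc (lookup-injective u e)

Unique-⊆⇒length≤ : ∀ {A : Set} {xs ys : List A} → Unique xs →
                   (∀ {x} → x ∈ xs → x ∈ ys) → length xs ≤ length ys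
Unique-⊆⇒length≤ {A} {xs} u xs⊆ys = injective⇒≤ position-injective
  where
  position : Fin (length xs) → Fin _
  position i = Any.index (xs⊆ys (∈-lookup i))
  position-injective : ∀ {i j} → position i ≡ position j → i ≡ j
  position-injective {i} {j} e = lookup-injective u
    (Membershipₛ.index-injective (setoid A) (xs⊆ys (∈-lookup i)) (xs⊆ys (∈-lookup j)) e)

Unique-∷ʳ : ∀ {A : Set} {xs : List A} {a} → Unique xs → a ∉ xs → Unique (xs ∷ʳ a)
Unique-∷ʳ {xs = []}    []        _   = [] ∷ []
Unique-∷ʳ {xs = _ ∷ _} (x∉ ∷ u) a∉ =
  Allₚ.++⁺ x∉ ((λ e → a∉ (here (sym e))) ∷ []) ∷ Unique-∷ʳ u (a∉ ∘ there)

Unique-++⁻ˡ : ∀ {A : Set} (xs : List A) {ys} → Unique (xs ++ ys) → Unique xs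
Unique-++⁻ˡ []       _         = []
Unique-++⁻ˡ (_ ∷ xs) (x∉ ∷ u) = Allₚ.++⁻ˡ xs x∉ ∷ Unique-++⁻ˡ xs u

Unique-++⁻ʳ : ∀ {A : Set} (xs : List A) {ys} → Unique (xs ++ ys) → Unique ys
Unique-++⁻ʳ []       u       = u
Unique-++⁻ʳ (_ ∷ xs) (_ ∷ u) = Unique-++⁻ʳ xs u

from-does : ∀ {A : Set} (a? : Dec A) → does a? ≡ true → A
from-does (yes a) _ = a

just≢nothing : ∀ {A : Set} {a : A} → just a ≢ nothing
just≢nothing ()

map-≡-just : ∀ {A B : Set} (f : A → B) {mx : Maybe A} {b} → Maybe.map f mx ≡ just b →
             ∃ λ a → mx ≡ just a × f a ≡ b
map-≡-just f {just a} refl = a , refl , refl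

maxF-upper : ∀ m (f : Fin m → ℕ) i → f i ≤ maxF m f
maxF-upper (suc m) f zero    = ℕₚ.m≤m⊔n (f zero) _
maxF-upper (suc m) f (suc i) = ℕₚ.≤-trans (maxF-upper m (f ∘ suc) i) (ℕₚ.m≤n⊔m (f zero) _)

maxF-least : ∀ m (f : Fin m → ℕ) {b} → (∀ i → f i ≤ b) → maxF m f ≤ b
maxF-least zero    f _    = z≤n
maxF-least (suc m) f f≤b = ℕₚ.⊔-lub (f≤b zero) (maxF-least m (f ∘ suc) (f≤b ∘ suc))

prefix-linear : ∀ {A : Set} (xs ys zs ws : List A) → xs ++ ys ≡ zs ++ ws →
                (∃ λ ds → zs ≡ xs ++ ds) ⊎ (∃ λ ds → xs ≡ zs ++ ds)
prefix-linear []       _  zs       _  _  = inj₁ (zs , refl)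
prefix-linear (x ∷ xs) _  []       _  _  = inj₂ (x ∷ xs , refl)
prefix-linear (x ∷ xs) ys (z ∷ zs) ws eq with Listₚ.∷-injective eq
... | refl , eq′ = Sum.map (Product.map₂ (cong (x ∷_))) (Product.map₂ (cong (x ∷_)))
                                (prefix-linear xs ys zs ws eq′)

elements : ∀ {n} → Subset n → List (Fin n)
elements []            = []
elements (true  ∷ p) = zero ∷ map Fin.suc (elements p)
elements (false ∷ p) = map Fin.suc (elements p)

length-elements : ∀ {n} (p : Subset n) → length (elements p) ≡ ∣ p ∣
length-elements []          = refl
length-elements (true  ∷ p) = cong suc (trans (length-map Fin.suc (elements p)) (length-elements p))
length-elements (false ∷ p) = trans (length-map Fin.suc (elements p)) (length-elements p)

elements-unique : ∀ {n} (p : Subset n) → Unique (elements p)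
elements-unique []          = []
elements-unique (true  ∷ p) = Allₚ.map⁺ (All.tabulate (λ _ ())) ∷ Uniqueₚ.map⁺ suc-injective (elements-unique p)
elements-unique (false ∷ p) = Uniqueₚ.map⁺ suc-injective (elements-unique p)

∈-elements⁺ : ∀ {n} (p : Subset n) {x} → x ∈ₛ p → x ∈ elements p
∈-elements⁺ (true  ∷ p) here       = here refl
∈-elements⁺ (true  ∷ p) (there x∈) = there (∈-map⁺ Fin.suc (∈-elements⁺ p x∈))
∈-elements⁺ (false ∷ p) (there x∈) = ∈-map⁺ Fin.suc (∈-elements⁺ p x∈)

∈-elements⁻ : ∀ {n} (p : Subset n) {x} → x ∈ elements p → x ∈ₛ p
∈-elements⁻ (true  ∷ p) (here refl) = here
∈-elements⁻ (true  ∷ p) (there x∈) with ∈-map⁻ Fin.suc x∈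
... | _ , y∈ , refl = there (∈-elements⁻ p y∈)
∈-elements⁻ (false ∷ p) x∈ with ∈-map⁻ Fin.suc x∈
... | _ , y∈ , refl = there (∈-elements⁻ p y∈)

∣p∣≤length : ∀ {n} (p : Subset n) {xs} → (∀ {x} → x ∈ₛ p → x ∈ xs) → ∣ p ∣ ≤ length xs
∣p∣≤length p p⊆xs = subst (_≤ _) (length-elements p)
  (Unique-⊆⇒length≤ (elements-unique p) (λ x∈ → p⊆xs (∈-elements⁻ p x∈)))

length≤∣p∣ : ∀ {n} (p : Subset n) {xs} → Unique xs → (∀ {x} → x ∈ xs → x ∈ₛ p) → length xs ≤ ∣ p ∣
length≤∣p∣ p u xs⊆p = subst (_ ≤_) (length-elements p)
  (Unique-⊆⇒length≤ u (λ x∈ → ∈-elements⁺ p (xs⊆p x∈)))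

∣p∣≤k : ∀ {n k} (p : Subset n) (slot : Fin k → Maybe (Fin n)) →
        (∀ {x} → x ∈ₛ p → ∃ λ ℓ → slot ℓ ≡ just x) → ∣ p ∣ ≤ k
∣p∣≤k p slot covers = subst (_≤ _) (length-elements p) (injective⇒≤ slotOf-injective)
  where
  slotOf : Fin (length (elements p)) → Fin _
  slotOf i = proj₁ (covers (∈-elements⁻ p (∈-lookup i)))
  slotOf-injective : ∀ {i j} → slotOf i ≡ slotOf j → i ≡ j
  slotOf-injective {i} {j} e = lookup-injective (elements-unique p) (Maybeₚ.just-injective (begin
    just (lookup (elements p) i)  ≡⟨ sym (proj₂ (covers (∈-elements⁻ p (∈-lookup i)))) ⟩
    slot (slotOf i)               ≡⟨ cong slot e ⟩
    slot (slotOf j)               ≡⟨ proj₂ (covers (∈-elements⁻ p (∈-lookup j))) ⟩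
    just (lookup (elements p) j)  ∎))
    where open ≡-Reasoning

subsetOf : ∀ {n} {P : Fin n → Set} → Decidable P → Subset n
subsetOf P? = Vec.tabulate (λ x → does (P? x))

∈-subsetOf⁺ : ∀ {n} {P : Fin n → Set} (P? : Decidable P) {x} → P x → x ∈ₛ subsetOf P?
∈-subsetOf⁺ P? {x} px = Vecₚ.lookup⇒[]= x _ (trans (Vecₚ.lookup∘tabulate _ x) (dec-true (P? x) px))

∈-subsetOf⁻ : ∀ {n} {P : Fin n → Set} (P? : Decidable P) {x} → x ∈ₛ subsetOf P? → P x
∈-subsetOf⁻ P? {x} x∈ with P? x | trans (sym (Vecₚ.lookup∘tabulate _ x)) (Vecₚ.[]=⇒lookup x∈)
... | yes px | _ = px

enumerate : ∀ {A : Set} {k} → List A → Fin k → Maybe A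
enumerate []       _       = nothing
enumerate (a ∷ _)  zero    = just a
enumerate (_ ∷ as) (suc ℓ) = enumerate as ℓ

∈⇒enumerated : ∀ {A : Set} {k} {as : List A} {a} → a ∈ as → length as ≤ k →
               ∃ λ (ℓ : Fin k) → enumerate as ℓ ≡ just a
∈⇒enumerated {k = suc k} (here refl) _        = zero , refl
∈⇒enumerated {k = suc k} (there a∈) (s≤s len≤) = Product.map suc id (∈⇒enumerated a∈ len≤)

∃-missedValue : ∀ {k} (g : Fin k → Maybe (Fin k)) {ℓ₀} → g ℓ₀ ≡ nothing →
                ∃ λ c → ∀ ℓ → g ℓ ≢ just c
-- Otherwise, choosing a preimage of every value would inject Fin k into Fin k minus ℓ₀.
∃-missedValue {suc k} g {ℓ₀} gℓ₀≡nothing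
  with any? (λ c → all? (λ ℓ → ¬? (Maybeₚ.≡-dec Fin._≟_ (g ℓ) (just c))))
... | yes missed = missed
... | no allHit = ⊥-elim (ℕₚ.1+n≰n (injective⇒≤ {f = punchedPreimage} punchedPreimage-injective))
  where
  _≟_ : ∀ (a b : Maybe (Fin (suc k))) → Dec (a ≡ b)
  _≟_ = Maybeₚ.≡-dec Fin._≟_
  preimage : ∀ c → ∃ λ ℓ → ¬ ¬ g ℓ ≡ just c
  preimage c = ¬∀⟶∃¬ _ _ (λ ℓ → ¬? (g ℓ ≟ just c)) (λ unhit → allHit (c , unhit))
  hits : ∀ c → g (proj₁ (preimage c)) ≡ just c
  hits c = decidable-stable (g _ ≟ just c) (proj₂ (preimage c))
  ℓ₀-unhit : ∀ c → ℓ₀ ≢ proj₁ (preimage c)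
  ℓ₀-unhit c refl with trans (sym gℓ₀≡nothing) (hits c)
  ... | ()
  punchedPreimage : Fin (suc k) → Fin k
  punchedPreimage c = punchOut (ℓ₀-unhit c)
  punchedPreimage-injective : ∀ {c d} → punchedPreimage c ≡ punchedPreimage d → c ≡ d
  punchedPreimage-injective {c} {d} e = Maybeₚ.just-injective
    (trans (sym (hits c)) (trans (cong g (punchOut-injective (ℓ₀-unhit c) (ℓ₀-unhit d) e)) (hits d)))

module _ {N : ℕ} {Q : Fin N → Set} (Q? : Decidable Q) (key : Fin N → ℕ) where

  private
    candidates : List (Fin N)
    candidates = filter Q? (allFin N)

    ∈-candidates : ∀ {s} → Q s → s ∈ candidates
    ∈-candidates Qs = Membershipₚ.∈-filter⁺ Q? (∈-allFin _) Qs

  argminᶠ : ∀ {t₀} → Q t₀ → ∃ λ t → Q t × ∀ s → Q s → key t ≤ key s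
  argminᶠ {t₀} Qt₀ = argmin key t₀ candidates , argmin-all key Qt₀ (Allₚ.all-filter Q? (allFin N)) ,
                     λ s Qs → All.lookup (f[argmin]≤f[xs] {f = key} t₀ candidates) (∈-candidates Qs)

  argmaxᶠ : (∃ λ t → Q t × ∀ s → Q s → key s ≤ key t) ⊎ (∀ s → ¬ Q s)
  argmaxᶠ with candidates | Allₚ.all-filter Q? (allFin N) | ∈-candidates
  ... | []     | _          | ∈[]     = inj₂ (λ s Qs → case ∈[] Qs of λ ())
  ... | c ∷ cs | Qc ∷ Q-cs | ∈c∷cs = inj₁ (argmax key c cs , argmax-all key Qc Q-cs , maximal)
    where
    maximal : ∀ s → Q s → key s ≤ key (argmax key c cs)
    maximal s Qs with ∈c∷cs Qs
    ... | here refl = f[⊥]≤f[argmax] {f = key} c cs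
    ... | there s∈  = All.lookup (f[xs]≤f[argmax] {f = key} c cs) s∈

module Forest {n : ℕ} (par : Fin n → Maybe (Fin n)) where

  parent-functional : ∀ {v w w′} → par v ≡ just w → par v ≡ just w′ → w ≡ w′
  parent-functional e e′ = Maybeₚ.just-injective (trans (sym e) e′)

  root≢child : ∀ {v w} → par v ≡ nothing → par v ≢ just w
  root≢child e e′ with trans (sym e) e′
  ... | ()

  Anc-trans : ∀ {u v w} → Anc par u v → Anc par v w → Anc par u w
  Anc-trans u⪯v here         = u⪯v
  Anc-trans u⪯v (up e v⪯w′) = up e (Anc-trans u⪯v v⪯w′)

  Anc-root : ∀ {u v} → Anc par u v → par v ≡ nothing → u ≡ v
  Anc-root here        _ = refl
  Anc-root (up e _) e′ = ⊥-elim (root≢child e′ e)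

  Anc-parent : ∀ {u v w} → Anc par u v → u ≢ v → par v ≡ just w → Anc par u w
  Anc-parent here        u≢v _  = ⊥-elim (u≢v refl)
  Anc-parent (up e u⪯w) _   e′ rewrite parent-functional e e′ = u⪯w

  Anc-linear : ∀ {a b v} → Anc par a v → Anc par b v → Anc par a b ⊎ Anc par b a
  Anc-linear here        b⪯v          = inj₂ b⪯v
  Anc-linear (up e a⪯w) here         = inj₁ (up e a⪯w)
  Anc-linear (up e a⪯w) (up e′ b⪯w′) rewrite parent-functional e e′ = Anc-linear a⪯w b⪯w′

  RootDist-functional : ∀ {v m m′} → RootDist par v m → RootDist par v m′ → m ≡ m′
  RootDist-functional (root _)   (root _)    = refl
  RootDist-functional (root e)   (step e′ _) = ⊥-elim (root≢child e e′)
  RootDist-functional (step e _) (root e′)   = ⊥-elim (root≢child e′ e)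
  RootDist-functional (step e d) (step e′ d′) rewrite parent-functional e e′ =
    cong suc (RootDist-functional d d′)

  private
    Maybe-UIP : ∀ {a b : Maybe (Fin n)} (e e′ : a ≡ b) → e ≡ e′
    Maybe-UIP = Decidable⇒UIP.≡-irrelevant (Maybeₚ.≡-dec Fin._≟_)

  RootDist-irrelevant : ∀ {v m} (d d′ : RootDist par v m) → d ≡ d′
  RootDist-irrelevant (root e)   (root e′)    = cong root (Maybe-UIP e e′)
  RootDist-irrelevant (root e)   (step e′ _)  = ⊥-elim (root≢child e e′)
  RootDist-irrelevant (step e _) (root e′)    = ⊥-elim (root≢child e′ e)
  RootDist-irrelevant (step e d) (step e′ d′) with parent-functional e e′
  ... | refl = cong₂ step (Maybe-UIP e e′) (RootDist-irrelevant d d′)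

  RootDist-positive : ∀ {v m} → RootDist par v m → 1 ≤ m
  RootDist-positive (root _)   = s≤s z≤n
  RootDist-positive (step _ _) = s≤s z≤n

  RootDist-parent< : ∀ {v w m m′} → RootDist par v m → par v ≡ just w → RootDist par w m′ → m′ < m
  RootDist-parent< (root e)   e′ _  = ⊥-elim (root≢child e e′)
  RootDist-parent< (step e d) e′ d′ rewrite parent-functional e e′ =
    s≤s (ℕₚ.≤-reflexive (RootDist-functional d′ d))

  Anc⇒RootDist≤ : ∀ {u v m} → Anc par u v → RootDist par v m → ∃ λ m′ → RootDist par u m′ × m′ ≤ m
  Anc⇒RootDist≤ here d = _ , d , ℕₚ.≤-refl
  Anc⇒RootDist≤ (up e _)   (root e′)   = ⊥-elim (root≢child e′ e)
  Anc⇒RootDist≤ (up e u⪯w) (step e′ d) rewrite parent-functional e e′ =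
    Product.map₂ (Product.map₂ ℕₚ.m≤n⇒m≤1+n) (Anc⇒RootDist≤ u⪯w d)

  Anc-antisym : ∀ {u v m} → RootDist par v m → Anc par u v → Anc par v u → u ≡ v
  Anc-antisym d here _ = refl
  Anc-antisym d (up e u⪯w) v⪯u with d
  ... | root e′   = ⊥-elim (root≢child e′ e)
  ... | step e′ d′ rewrite parent-functional e e′ with Anc⇒RootDist≤ (Anc-trans v⪯u u⪯w) d′
  ...   | _ , d″ , m″≤ rewrite RootDist-functional d″ (step e′ d′) = ⊥-elim (ℕₚ.1+n≰n m″≤)

  Anc? : ∀ {v m} → RootDist par v m → ∀ u → Dec (Anc par u v)
  Anc? {v} d u with u Fin.≟ v
  ... | yes refl = yes here
  Anc? (root e)   u | no u≢v = no (λ u⪯v → u≢v (Anc-root u⪯v e))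
  Anc? (step e d) u | no u≢v with Anc? d u
  ...   | yes u⪯w = yes (up e u⪯w)
  ...   | no u⋠w  = no (λ u⪯v → u⋠w (Anc-parent u⪯v u≢v e))

  pathToRoot : ∀ {v m} → RootDist par v m → List (Fin n)
  pathToRoot {v} (root _)   = v ∷ []
  pathToRoot {v} (step _ d) = v ∷ pathToRoot d

  length-pathToRoot : ∀ {v m} (d : RootDist par v m) → length (pathToRoot d) ≡ m
  length-pathToRoot (root _)   = refl
  length-pathToRoot (step _ d) = cong suc (length-pathToRoot d)

  ∈-pathToRoot⁺ : ∀ {u v m} (d : RootDist par v m) → Anc par u v → u ∈ pathToRoot d
  ∈-pathToRoot⁺ (root _)    here        = here refl
  ∈-pathToRoot⁺ (step _ _)  here        = here refl
  ∈-pathToRoot⁺ (root e)    (up e′ _)   = ⊥-elim (root≢child e e′)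
  ∈-pathToRoot⁺ (step e d)  (up e′ u⪯w) rewrite parent-functional e′ e = there (∈-pathToRoot⁺ d u⪯w)

  ∈-pathToRoot⁻ : ∀ {u v m} (d : RootDist par v m) → u ∈ pathToRoot d → Anc par u v
  ∈-pathToRoot⁻ (root _)   (here refl) = here
  ∈-pathToRoot⁻ (step _ _) (here refl) = here
  ∈-pathToRoot⁻ (step e d) (there u∈)  = up e (∈-pathToRoot⁻ d u∈)

  pathToRoot-unique : ∀ {v m} (d : RootDist par v m) → Unique (pathToRoot d)
  pathToRoot-unique (root _)   = [] ∷ []
  pathToRoot-unique (step e d) = All.tabulate v∉ ∷ pathToRoot-unique d
    where
    v∉ : ∀ {u} → u ∈ pathToRoot d → _ ≢ u
    v∉ u∈ refl with Anc⇒RootDist≤ (∈-pathToRoot⁻ d u∈) d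
    ... | _ , d′ , m′≤ rewrite RootDist-functional d′ (step e d) = ℕₚ.1+n≰n m′≤

E? : (G : Graph) → ∀ u v → Dec (E G u v)
E? G u v = Graph.adj G u v Boolₚ.≟ true

module Walks (G : Graph) where

  E-sym : ∀ {a b} → E G a b → E G b a
  E-sym {a} {b} e = trans (Graph.sym G b a) e

  E-irrefl : ∀ {a b} → E G a b → a ≢ b
  E-irrefl {a} e refl with trans (sym e) (Graph.irrefl G a)
  ... | ()

  infixr 5 _++ᵂ_
  _++ᵂ_ : ∀ {a b c} → Walk G a b → Walk G b c → Walk G a c
  []      ++ᵂ q = q
  (e ∷ p) ++ᵂ q = e ∷ (p ++ᵂ q)

  initVerts : ∀ {a b} → Walk G a b → List (V G)
  initVerts []          = []
  initVerts {a} (_ ∷ p) = a ∷ initVerts p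

  verts≡initVerts∷ʳ : ∀ {a b} (p : Walk G a b) → verts p ≡ initVerts p ∷ʳ b
  verts≡initVerts∷ʳ []          = refl
  verts≡initVerts∷ʳ {a} (_ ∷ p) = cong (a ∷_) (verts≡initVerts∷ʳ p)

  verts-++ᵂ : ∀ {a b c} (p : Walk G a b) (q : Walk G b c) → verts (p ++ᵂ q) ≡ initVerts p ++ verts q
  verts-++ᵂ []          q = refl
  verts-++ᵂ {a} (_ ∷ p) q = cong (a ∷_) (verts-++ᵂ p q)

  verts-∷ʳᵂ : ∀ {a b c} (p : Walk G a b) (e : E G b c) → verts (p ++ᵂ e ∷ []) ≡ verts p ∷ʳ c
  verts-∷ʳᵂ {b = b} {c} p e = begin
    verts (p ++ᵂ e ∷ [])         ≡⟨ verts-++ᵂ p (e ∷ []) ⟩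
    initVerts p ++ b ∷ c ∷ []    ≡⟨ sym (Listₚ.++-assoc (initVerts p) (b ∷ []) (c ∷ [])) ⟩
    (initVerts p ∷ʳ b) ∷ʳ c      ≡⟨ cong (_∷ʳ c) (sym (verts≡initVerts∷ʳ p)) ⟩
    verts p ∷ʳ c                 ∎
    where open ≡-Reasoning

  head∈verts : ∀ {a b} (p : Walk G a b) → a ∈ verts p
  head∈verts []      = here refl
  head∈verts (_ ∷ _) = here refl

  last∈verts : ∀ {a b} (p : Walk G a b) → b ∈ verts p
  last∈verts []      = here refl
  last∈verts (_ ∷ p) = there (last∈verts p)

  All-head : ∀ {P : V G → Set} {a b} (p : Walk G a b) → All P (verts p) → P a
  All-head []      (pa ∷ _) = pa
  All-head (_ ∷ _) (pa ∷ _) = pa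

  All-++ᵂ : ∀ {P : V G → Set} {a b c} (p : Walk G a b) (q : Walk G b c) →
            All P (verts p) → All P (verts q) → All P (verts (p ++ᵂ q))
  All-++ᵂ []      q _          Pq = Pq
  All-++ᵂ (_ ∷ p) q (Pa ∷ Pp) Pq = Pa ∷ All-++ᵂ p q Pp Pq

  reverseᵂ : ∀ {a b} → Walk G a b → Walk G b a
  reverseᵂ []      = []
  reverseᵂ (e ∷ p) = reverseᵂ p ++ᵂ E-sym e ∷ []

  verts-reverseᵂ-∷ : ∀ {a w b} (e : E G a w) (p : Walk G w b) →
                     verts (reverseᵂ (e ∷ p)) ≡ verts (reverseᵂ p) ∷ʳ a
  verts-reverseᵂ-∷ e p = verts-∷ʳᵂ (reverseᵂ p) (E-sym e)

  ∈-reverseᵂ⁻ : ∀ {a b x} (p : Walk G a b) → x ∈ verts (reverseᵂ p) → x ∈ verts p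
  ∈-reverseᵂ⁻ []      x∈ = x∈
  ∈-reverseᵂ⁻ (e ∷ p) x∈ with Membershipₚ.∈-++⁻ (verts (reverseᵂ p)) (subst (_ ∈_) (verts-reverseᵂ-∷ e p) x∈)
  ... | inj₁ x∈′        = there (∈-reverseᵂ⁻ p x∈′)
  ... | inj₂ (here refl) = here refl

  All-reverseᵂ : ∀ {P : V G → Set} {a b} (p : Walk G a b) → All P (verts p) → All P (verts (reverseᵂ p))
  All-reverseᵂ p Pp = All.tabulate (λ x∈ → All.lookup Pp (∈-reverseᵂ⁻ p x∈))

  reverseᵂ-unique : ∀ {a b} (p : Walk G a b) → Unique (verts p) → Unique (verts (reverseᵂ p))
  reverseᵂ-unique []      u         = u
  reverseᵂ-unique (e ∷ p) (a∉ ∷ u) = subst Unique (sym (verts-reverseᵂ-∷ e p))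
    (Unique-∷ʳ (reverseᵂ-unique p u) (λ a∈ → All.lookup a∉ (∈-reverseᵂ⁻ p a∈) refl))

  length-reverseᵂ : ∀ {a b} (p : Walk G a b) → length (verts (reverseᵂ p)) ≡ length (verts p)
  length-reverseᵂ []      = refl
  length-reverseᵂ (e ∷ p) = begin
    length (verts (reverseᵂ (e ∷ p)))  ≡⟨ cong length (verts-reverseᵂ-∷ e p) ⟩
    length (verts (reverseᵂ p) ∷ʳ _)   ≡⟨ Listₚ.length-++ (verts (reverseᵂ p)) ⟩
    length (verts (reverseᵂ p)) + 1    ≡⟨ ℕₚ.+-comm _ 1 ⟩
    suc (length (verts (reverseᵂ p)))  ≡⟨ cong suc (length-reverseᵂ p) ⟩
    length (verts (e ∷ p))             ∎
    where open ≡-Reasoning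

  unique-loop : ∀ {a} (p : Walk G a a) → Unique (verts p) → verts p ≡ a ∷ []
  unique-loop []      _         = refl
  unique-loop (_ ∷ p) (a∉ ∷ _) = ⊥-elim (All.lookup a∉ (last∈verts p) refl)

  suffixFrom : ∀ {c a b} (p : Walk G c b) → a ∈ verts p →
               Σ (Walk G a b) λ q → ∃ λ pre → verts p ≡ pre ++ verts q
  suffixFrom []          (here refl) = [] , [] , refl
  suffixFrom (e ∷ p)     (here refl) = e ∷ p , [] , refl
  suffixFrom {c} (_ ∷ p) (there a∈)  with suffixFrom p a∈
  ... | q , pre , eq = q , c ∷ pre , cong (c ∷_) eq

  toPath : ∀ {a b} (p : Walk G a b) →
           Σ (Walk G a b) λ q → Unique (verts q) × (∀ {x} → x ∈ verts q → x ∈ verts p)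
  toPath [] = [] , [] ∷ [] , id
  toPath {a} (e ∷ p) with toPath p
  ... | q , u , q⊆p with Any.any? (a Fin.≟_) (verts q)
  ...   | yes a∈ with suffixFrom q a∈
  ...     | q′ , pre , eq = q′ , Unique-++⁻ʳ pre (subst Unique eq u) ,
                            (λ x∈ → there (q⊆p (subst (_ ∈_) (sym eq) (Membershipₚ.∈-++⁺ʳ pre x∈))))
  toPath {a} (e ∷ p) | q , u , q⊆p | no a∉ = e ∷ q , Allₚ.¬Any⇒All¬ (verts q) a∉ ∷ u , e∷q⊆e∷p
    where
    e∷q⊆e∷p : ∀ {x} → x ∈ verts (e ∷ q) → x ∈ verts (e ∷ p)
    e∷q⊆e∷p (here refl) = here refl
    e∷q⊆e∷p (there x∈)  = there (q⊆p x∈)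

  splitᵂ : ∀ {a b x} (p : Walk G a b) → x ∈ verts p →
           Σ (Walk G a x) λ p₁ → Σ (Walk G x b) λ p₂ → verts p ≡ initVerts p₁ ++ verts p₂
  splitᵂ []          (here refl) = [] , [] , refl
  splitᵂ (e ∷ p)     (here refl) = [] , e ∷ p , refl
  splitᵂ {a} (e ∷ p) (there x∈)  with splitᵂ p x∈
  ... | p₁ , p₂ , eq = e ∷ p₁ , p₂ , cong (a ∷_) eq

  tailVerts : ∀ {a b} → Walk G a b → List (V G)
  tailVerts []      = []
  tailVerts (_ ∷ p) = verts p

  verts≡∷tailVerts : ∀ {a b} (p : Walk G a b) → verts p ≡ a ∷ tailVerts p
  verts≡∷tailVerts []      = refl
  verts≡∷tailVerts (_ ∷ _) = refl

  initVerts++verts : ∀ {a x b} (p₁ : Walk G a x) (p₂ : Walk G x b) →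
                     initVerts p₁ ++ verts p₂ ≡ verts p₁ ++ tailVerts p₂
  initVerts++verts {x = x} p₁ p₂ = begin
    initVerts p₁ ++ verts p₂                 ≡⟨ cong (initVerts p₁ ++_) (verts≡∷tailVerts p₂) ⟩
    initVerts p₁ ++ x ∷ tailVerts p₂         ≡⟨ sym (Listₚ.++-assoc (initVerts p₁) (x ∷ []) (tailVerts p₂)) ⟩
    (initVerts p₁ ∷ʳ x) ++ tailVerts p₂      ≡⟨ cong (_++ tailVerts p₂) (sym (verts≡initVerts∷ʳ p₁)) ⟩
    verts p₁ ++ tailVerts p₂                 ∎
    where open ≡-Reasoning

  2≤length-verts : ∀ {a b} → a ≢ b → (p : Walk G a b) → 2 ≤ length (verts p)
  2≤length-verts a≢b []          = ⊥-elim (a≢b refl)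
  2≤length-verts _   (_ ∷ [])    = s≤s (s≤s z≤n)
  2≤length-verts _   (_ ∷ _ ∷ _) = s≤s (s≤s z≤n)

module ParentGraph {N : ℕ} (par : Fin N → Maybe (Fin N)) (rank : Fin N → ℕ)
                   (rank-parent< : ∀ {s t} → par s ≡ just t → rank t < rank s) where

  open Forest par

  parent? : ∀ s t → Dec (par s ≡ just t)
  parent? s t = Maybeₚ.≡-dec Fin._≟_ (par s) (just t)

  parentGraph : Graph
  parentGraph = record
    { n      = N
    ; adj    = λ s t → does (parent? s t) ∨ does (parent? t s)
    ; sym    = λ s t → Boolₚ.∨-comm (does (parent? s t)) _
    ; irrefl = irreflexive }
    where
    irreflexive : ∀ s → does (parent? s s) ∨ does (parent? s s) ≡ false
    irreflexive s rewrite dec-false (parent? s s) (λ e → ℕₚ.<-irrefl refl (rank-parent< e)) = refl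

  open Walks parentGraph

  edge⇒parent : ∀ {s t} → E parentGraph s t → par s ≡ just t ⊎ par t ≡ just s
  edge⇒parent {s} {t} e with parent? s t | parent? t s
  edge⇒parent _  | yes s→t | _       = inj₁ s→t
  edge⇒parent _  | no _    | yes t→s = inj₂ t→s
  edge⇒parent () | no _    | no _

  parent⇒edge : ∀ {s t} → par s ≡ just t → E parentGraph s t
  parent⇒edge {s} {t} e rewrite dec-true (parent? s t) e = refl

  rank-Anc : ∀ {u v} → Anc par u v → rank u ≤ rank v
  rank-Anc here       = ℕₚ.≤-refl
  rank-Anc (up e u⪯w) = ℕₚ.≤-trans (rank-Anc u⪯w) (ℕₚ.<⇒≤ (rank-parent< e))

  -- After a step down, a path cannot step up again without revisiting a vertex.
  unique-walk-descends : ∀ {s v} (p : Walk parentGraph s v) → Unique (verts p) →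
                         (∀ {y} → par s ≡ just y → y ∉ verts p) → All (λ t → Anc par t v) (verts p)
  unique-walk-descends []                _            _          = here ∷ []
  unique-walk-descends (_∷_ {w = x} e p) (s∉p ∷ u-p) avoids-par with edge⇒parent e
  ... | inj₁ s→x = ⊥-elim (avoids-par s→x (there (head∈verts p)))
  ... | inj₂ x→s = Anc-trans (up x→s here) (All-head p descends) ∷ descends
    where
    descends : All (λ t → Anc par t _) (verts p)
    descends = unique-walk-descends p u-p
      (λ x→y y∈p → All.lookup s∉p (subst (_∈ verts p) (parent-functional x→y x→s) y∈p) refl)

  private
    parent-cycle-short : ∀ {w u} → par w ≡ just u → (p : Walk parentGraph w u) →
                         Unique (verts p) → length (verts p) ≤ 2
    parent-cycle-short _ [] _ = s≤s z≤n
    parent-cycle-short w→u (_∷_ {w = x} e p) (w∉p ∷ u-p) with edge⇒parent e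
    ... | inj₁ w→x rewrite parent-functional w→u w→x | unique-loop p u-p = ℕₚ.≤-refl
    ... | inj₂ x→w = ⊥-elim (ℕₚ.<-irrefl refl (ℕₚ.≤-trans (rank-parent< w→u)
          (ℕₚ.≤-trans (ℕₚ.<⇒≤ (rank-parent< x→w)) (rank-Anc (All-head p descends)))))
      where
      descends : All (λ t → Anc par t _) (verts p)
      descends = unique-walk-descends p u-p
        (λ x→y y∈p → All.lookup w∉p (subst (_∈ verts p) (parent-functional x→y x→w) y∈p) refl)

  acyclic : Acyclic parentGraph
  acyclic u w e p u-p with edge⇒parent e
  ... | inj₂ w→u = parent-cycle-short w→u p u-p
  ... | inj₁ u→w = subst (_≤ 2) (length-reverseᵂ p)
                     (parent-cycle-short u→w (reverseᵂ p) (reverseᵂ-unique p u-p))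

  walkDown : ∀ {a t} → Anc par a t → Walk parentGraph t a
  walkDown here       = []
  walkDown (up e a⪯w) = parent⇒edge e ∷ walkDown a⪯w

  walkDown-between : ∀ {a t} (a⪯t : Anc par a t) →
                     All (λ y → Anc par a y × Anc par y t) (verts (walkDown a⪯t))
  walkDown-between here       = (here , here) ∷ []
  walkDown-between (up e a⪯w) =
    (up e a⪯w , here) ∷ All.map (Product.map₂ (λ y⪯w → Anc-trans y⪯w (up e here))) (walkDown-between a⪯w)

  connected : ∀ r → (∀ t → Anc par r t) → Connected parentGraph
  connected r r⪯ a b = walkDown (r⪯ a) ++ᵂ reverseᵂ (walkDown (r⪯ b))

  Ancestor⇒Anc : ∀ {r t v} → par r ≡ nothing → Ancestor parentGraph r t v → Anc par t v
  Ancestor⇒Anc r-root (p , u , t∈) =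
    All.lookup (unique-walk-descends p u (λ r→y → ⊥-elim (root≢child r-root r→y))) t∈

module RootedTree (T : Graph) (isTree : IsTree T) (r : V T) where

  open Walks T

  -- Two different first steps would close a cycle through a.
  paths-unique : ∀ {a b} (p q : Walk T a b) → Unique (verts p) → Unique (verts q) → verts p ≡ verts q
  paths-unique []      q _  u-q = sym (unique-loop q u-q)
  paths-unique (e ∷ p) [] u-p _   = unique-loop (e ∷ p) u-p
  paths-unique {a} (_∷_ {w = x} e p) (_∷_ {w = y} e′ q) (a∉p ∷ u-p) (a∉q ∷ u-q) with x Fin.≟ y
  ... | yes refl = cong (a ∷_) (paths-unique p q u-p u-q)
  ... | no x≢y = ⊥-elim (ℕₚ.1+n≰n (ℕₚ.≤-trans cycle-long (proj₂ isTree a x e cycle cycle-unique)))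
    where
    avoids-a : a ∉ verts (p ++ᵂ reverseᵂ q)
    avoids-a a∈ with Membershipₚ.∈-++⁻ (initVerts p) (subst (a ∈_) (verts-++ᵂ p (reverseᵂ q)) a∈)
    ... | inj₁ a∈p = All.lookup a∉p (subst (a ∈_) (sym (verts≡initVerts∷ʳ p)) (Membershipₚ.∈-++⁺ˡ a∈p)) refl
    ... | inj₂ a∈q = All.lookup a∉q (∈-reverseᵂ⁻ q a∈q) refl
    x→y : Walk T x y
    x→y = proj₁ (toPath (p ++ᵂ reverseᵂ q))
    cycle : Walk T x a
    cycle = x→y ++ᵂ E-sym e′ ∷ []
    cycle-unique : Unique (verts cycle)
    cycle-unique = subst Unique (sym (verts-∷ʳᵂ x→y (E-sym e′)))
      (Unique-∷ʳ (proj₁ (proj₂ (toPath (p ++ᵂ reverseᵂ q))))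
                 (avoids-a ∘ proj₂ (proj₂ (toPath (p ++ᵂ reverseᵂ q)))))
    cycle-long : 3 ≤ length (verts cycle)
    cycle-long rewrite verts-∷ʳᵂ x→y (E-sym e′) | Listₚ.length-++ (verts x→y) {a ∷ []} =
      ℕₚ.+-monoˡ-≤ 1 (2≤length-verts x≢y x→y)

  pathFromRoot : ∀ t → Walk T r t
  pathFromRoot t = proj₁ (toPath (proj₁ isTree r t))

  pathFromRoot-unique : ∀ t → Unique (verts (pathFromRoot t))
  pathFromRoot-unique t = proj₁ (proj₂ (toPath (proj₁ isTree r t)))

  ancestors : V T → List (V T)
  ancestors t = verts (pathFromRoot t)

  infix 4 _⊑_ _⊑?_
  _⊑_ : V T → V T → Set
  s ⊑ t = s ∈ ancestors t

  _⊑?_ : ∀ s t → Dec (s ⊑ t)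
  s ⊑? t = Any.any? (s Fin.≟_) (ancestors t)

  ⊑⇒Ancestor : ∀ {s t} → s ⊑ t → Ancestor T r s t
  ⊑⇒Ancestor {t = t} s⊑t = pathFromRoot t , pathFromRoot-unique t , s⊑t

  ancestors-split : ∀ {t x} {p₁ : Walk T r x} {p₂ : Walk T x t} →
                    ancestors t ≡ initVerts p₁ ++ verts p₂ → ancestors x ≡ verts p₁
  ancestors-split {t} {x} {p₁} {p₂} eq = paths-unique (pathFromRoot x) p₁ (pathFromRoot-unique x)
    (Unique-++⁻ˡ (verts p₁) (subst Unique (trans eq (initVerts++verts p₁ p₂)) (pathFromRoot-unique t)))

  ⊑⇒prefix : ∀ {s t} → s ⊑ t → ∃ λ ds → ancestors t ≡ ancestors s ++ ds
  ⊑⇒prefix {s} {t} s⊑t with splitᵂ (pathFromRoot t) s⊑t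
  ... | p₁ , p₂ , eq = tailVerts p₂ ,
        trans eq (trans (initVerts++verts p₁ p₂) (cong (_++ tailVerts p₂) (sym (ancestors-split eq))))

  ⊑-refl : ∀ t → t ⊑ t
  ⊑-refl t = last∈verts (pathFromRoot t)

  ⊑-trans : ∀ {s t u} → s ⊑ t → t ⊑ u → s ⊑ u
  ⊑-trans s⊑t t⊑u with ⊑⇒prefix t⊑u
  ... | _ , eq = subst (_ ∈_) (sym eq) (Membershipₚ.∈-++⁺ˡ s⊑t)

  ancestors-injective : ∀ {s t} → ancestors s ≡ ancestors t → s ≡ t
  ancestors-injective {s} {t} eq = proj₂ (Listₚ.∷ʳ-injective (initVerts (pathFromRoot s)) (initVerts (pathFromRoot t))
    (trans (sym (verts≡initVerts∷ʳ (pathFromRoot s))) (trans eq (verts≡initVerts∷ʳ (pathFromRoot t)))))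

  depth : V T → ℕ
  depth t = length (ancestors t)

  ⊑⇒depth≤ : ∀ {s t} → s ⊑ t → depth s ≤ depth t
  ⊑⇒depth≤ {s} s⊑t with ⊑⇒prefix s⊑t
  ... | ds , eq rewrite eq | Listₚ.length-++ (ancestors s) {ds} = ℕₚ.m≤m+n (depth s) (length ds)

  ⊑∧depth≥⇒≡ : ∀ {s t} → s ⊑ t → depth t ≤ depth s → s ≡ t
  ⊑∧depth≥⇒≡ {s} s⊑t depth≤ with ⊑⇒prefix s⊑t
  ... | [] , eq = ancestors-injective (sym (trans eq (Listₚ.++-identityʳ (ancestors s))))
  ... | d ∷ ds , eq = ⊥-elim (ℕₚ.m+1+n≰m (depth s)
          (subst (_≤ depth s) (trans (cong length eq) (Listₚ.length-++ (ancestors s))) depth≤))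

  ⊑-antisym : ∀ {s t} → s ⊑ t → t ⊑ s → s ≡ t
  ⊑-antisym s⊑t t⊑s = ⊑∧depth≥⇒≡ s⊑t (⊑⇒depth≤ t⊑s)

  ⊑-linear : ∀ {a b t} → a ⊑ t → b ⊑ t → a ⊑ b ⊎ b ⊑ a
  ⊑-linear {a} {b} a⊑t b⊑t with ⊑⇒prefix a⊑t | ⊑⇒prefix b⊑t
  ... | as , eq₁ | bs , eq₂ with prefix-linear (ancestors a) as (ancestors b) bs (trans (sym eq₁) eq₂)
  ...   | inj₁ (_ , eq) = inj₁ (subst (a ∈_) (sym eq) (Membershipₚ.∈-++⁺ˡ (⊑-refl a)))
  ...   | inj₂ (_ , eq) = inj₂ (subst (b ∈_) (sym eq) (Membershipₚ.∈-++⁺ˡ (⊑-refl b)))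

  private
    two-vertex-path : ∀ {t s} (p : Walk T t s) → length (verts p) ≤ 2 → t ≢ s → verts p ≡ t ∷ s ∷ []
    two-vertex-path []              _                  t≢s = ⊥-elim (t≢s refl)
    two-vertex-path (_ ∷ [])        _                  _   = refl
    two-vertex-path (_ ∷ _ ∷ [])    (s≤s (s≤s ()))     _
    two-vertex-path (_ ∷ _ ∷ _ ∷ _) (s≤s (s≤s ()))     _

  edge⇒parent-or-child : ∀ {s t} → E T s t → ancestors t ≡ ancestors s ∷ʳ t ⊎ ancestors s ≡ ancestors t ∷ʳ s
  edge⇒parent-or-child {s} {t} e with Any.any? (t Fin.≟_) (ancestors s)
  ... | no t∉ = inj₁ (trans (paths-unique (pathFromRoot t) (pathFromRoot s ++ᵂ e ∷ []) (pathFromRoot-unique t)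
                                (subst Unique (sym (verts-∷ʳᵂ (pathFromRoot s) e))
                                       (Unique-∷ʳ (pathFromRoot-unique s) t∉)))
                            (verts-∷ʳᵂ (pathFromRoot s) e))
  ... | yes t⊑s with splitᵂ (pathFromRoot s) t⊑s
  ...   | p₁ , p₂ , eq = inj₂ (begin
          ancestors s                  ≡⟨ trans eq (initVerts++verts p₁ p₂) ⟩
          verts p₁ ++ tailVerts p₂     ≡⟨ cong (verts p₁ ++_) p₂-tail ⟩
          verts p₁ ∷ʳ s                ≡⟨ cong (_∷ʳ s) (sym (ancestors-split eq)) ⟩
          ancestors t ∷ʳ s             ∎)
    where
    open ≡-Reasoning
    p₂-edge : verts p₂ ≡ t ∷ s ∷ []
    p₂-edge = two-vertex-path p₂
      (proj₂ isTree s t e p₂ (Unique-++⁻ʳ (initVerts p₁) (subst Unique eq (pathFromRoot-unique s))))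
      (E-irrefl e ∘ sym)
    p₂-tail : tailVerts p₂ ≡ s ∷ []
    p₂-tail = proj₂ (Listₚ.∷-injective (trans (sym (verts≡∷tailVerts p₂)) p₂-edge))

  walk-passes-or-stays-below : ∀ {a b c} (w : Walk T a b) → c ⊑ a → c ∈ verts w ⊎ c ⊑ b
  walk-passes-or-stays-below [] c⊑a = inj₂ c⊑a
  walk-passes-or-stays-below {a} {c = c} (_∷_ {w = a′} e w) c⊑a with c Fin.≟ a
  ... | yes refl = inj₁ (here refl)
  ... | no c≢a with edge⇒parent-or-child e
  ...   | inj₁ eq =
    Sum.map₁ there (walk-passes-or-stays-below w (subst (c ∈_) (sym eq) (Membershipₚ.∈-++⁺ˡ c⊑a)))
  ...   | inj₂ eq with Membershipₚ.∈-++⁻ (ancestors a′) (subst (c ∈_) eq c⊑a)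
  ...     | inj₁ c⊑a′        = Sum.map₁ there (walk-passes-or-stays-below w c⊑a′)
  ...     | inj₂ (here refl) = ⊥-elim (c≢a refl)

  walk-top : ∀ {a b} (w : Walk T a b) → ∃ λ m → m ∈ verts w × All (m ⊑_) (verts w)
  walk-top {a} [] = a , here refl , ⊑-refl a ∷ []
  walk-top {a} (_∷_ {w = a′} e w) with walk-top w | edge⇒parent-or-child e
  ... | m , m∈ , m⊑w | inj₂ eq =
    m , there m∈ , subst (m ∈_) (sym eq) (Membershipₚ.∈-++⁺ˡ (All-head w m⊑w)) ∷ m⊑w
  ... | m , m∈ , m⊑w | inj₁ eq with Membershipₚ.∈-++⁻ (ancestors a) (subst (m ∈_) eq (All-head w m⊑w))
  ...   | inj₁ m⊑a        = m , there m∈ , m⊑a ∷ m⊑w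
  ...   | inj₂ (here refl) = a , here refl , ⊑-refl a ∷ All.map (⊑-trans a⊑a′) m⊑w
    where
    a⊑a′ : a ⊑ a′
    a⊑a′ = subst (a ∈_) (sym eq) (Membershipₚ.∈-++⁺ˡ (⊑-refl a))

  connected-convex : ∀ {Q : V T → Set} → ConnectedSet T Q →
                     ∀ {a b c} → Q a → Q b → a ⊑ c → c ⊑ b → Q c
  connected-convex {Q} Q-conn {a} {b} Qa Qb a⊑c c⊑b with Q-conn b a Qb Qa
  ... | w , Q-w with walk-passes-or-stays-below w c⊑b
  ...   | inj₁ c∈w = All.lookup Q-w c∈w
  ...   | inj₂ c⊑a = subst Q (⊑-antisym a⊑c c⊑a) Qa

  connected-shallowest-⊑ : ∀ {Q : V T → Set} → ConnectedSet T Q →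
                           ∀ {a t} → Q a → (∀ s → Q s → depth a ≤ depth s) → Q t → a ⊑ t
  connected-shallowest-⊑ {Q} Q-conn {a} {t} Qa shallowest Qt with Q-conn t a Qt Qa
  ... | w , Q-w with walk-top w
  ...   | m , m∈ , m⊑w = subst (_⊑ t) m≡a (All-head w m⊑w)
    where
    m≡a : m ≡ a
    m≡a = ⊑∧depth≥⇒≡ (All.lookup m⊑w (last∈verts w)) (shallowest m (All.lookup Q-w m∈))

-- Slot forest covers

Boundary : (G : Graph) → (V G → Maybe (V G)) → V G → V G → Set
Boundary G par v u = u ≡ v ⊎ (Anc par u v × ∃ λ w → Anc par v w × E G u w)

-- A boundary of at most k elements is encoded as one covered by k slots.
record SlotForestCover (k q : ℕ) (G : Graph) : Set where
  field
    parent      : V G → Maybe (V G)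
    depth≤      : ∀ v → ∃ λ m → RootDist parent v m × m ≤ q
    edgeAnc     : ∀ u v → E G u v → Anc parent u v ⊎ Anc parent v u
    slot        : V G → Fin k → Maybe (V G)
    slot-covers : ∀ v u → Boundary G parent v u → ∃ λ ℓ → slot v ℓ ≡ just u

  rootDist : ∀ v → RootDist parent v (proj₁ (depth≤ v))
  rootDist v = proj₁ (proj₂ (depth≤ v))

  open Forest parent

  Boundary? : ∀ v u → Dec (Boundary G parent v u)
  Boundary? v u = (u Fin.≟ v) ⊎-dec (Anc? (rootDist v) u ×-dec any? (λ w → Anc? (rootDist w) v ×-dec E? G u w))

  Boundary⇒Anc : ∀ {v u} → Boundary G parent v u → Anc parent u v
  Boundary⇒Anc (inj₁ refl)       = here
  Boundary⇒Anc (inj₂ (u⪯v , _)) = u⪯v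

module ToTreeDecomposition {k q : ℕ} {G : Graph} (F : SlotForestCover k q G) where

  open SlotForestCover F
  open Forest parent

  n : ℕ
  n = Graph.n G

  liftParent : Maybe (Fin n) → Fin (suc n)
  liftParent nothing  = zero
  liftParent (just w) = suc w

  parentᵀ : Fin (suc n) → Maybe (Fin (suc n))
  parentᵀ zero    = nothing
  parentᵀ (suc v) = just (liftParent (parent v))

  rankᵀ : Fin (suc n) → ℕ
  rankᵀ zero    = 0
  rankᵀ (suc v) = proj₁ (depth≤ v)

  rankᵀ-parent< : ∀ {s t} → parentᵀ s ≡ just t → rankᵀ t < rankᵀ s
  rankᵀ-parent< {suc v} refl with parent v in eq
  ... | nothing = RootDist-positive (rootDist v)
  ... | just w  = RootDist-parent< (rootDist v) eq (rootDist w)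

  open ParentGraph parentᵀ rankᵀ rankᵀ-parent<
    using (parentGraph; acyclic; connected; walkDown; walkDown-between; Ancestor⇒Anc)
  module Tᶠ = Forest parentᵀ
  open Walks parentGraph using (_++ᵂ_; reverseᵂ; All-++ᵂ; All-reverseᵂ)

  Anc-suc⁺ : ∀ {u v} → Anc parent u v → Anc parentᵀ (suc u) (suc v)
  Anc-suc⁺ here       = here
  Anc-suc⁺ (up e u⪯w) = up (cong (just ∘ liftParent) e) (Anc-suc⁺ u⪯w)

  Anc-suc⁻ : ∀ {u v} → Anc parentᵀ (suc u) (suc v) → Anc parent u v
  Anc-suc⁻ here = here
  Anc-suc⁻ {v = v} (up e u⪯t) with parent v in eq
  Anc-suc⁻ (up refl u⪯t) | nothing with Tᶠ.Anc-root u⪯t refl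
  ... | ()
  Anc-suc⁻ (up refl u⪯t) | just w = up eq (Anc-suc⁻ u⪯t)

  zero⪯ : ∀ t → Anc parentᵀ zero t
  zero⪯ zero    = here
  zero⪯ (suc v) = go (rootDist v)
    where
    go : ∀ {v m} → RootDist parent v m → Anc parentᵀ zero (suc v)
    go (root e)   = up (cong (just ∘ liftParent) e) here
    go (step e d) = up (cong (just ∘ liftParent) e) (go d)

  bag : Fin (suc n) → Subset n
  bag zero    = ∅
  bag (suc v) = subsetOf (Boundary? v)

  Boundary-upward : ∀ {v x y} → Boundary G parent v x → Anc parent x y → Anc parent y v → Boundary G parent y x
  Boundary-upward {x = x} {y} b x⪯y y⪯v with x Fin.≟ y
  ... | yes x≡y = inj₁ x≡y
  Boundary-upward (inj₁ refl)                x⪯y y⪯v | no x≢y =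
    ⊥-elim (x≢y (Anc-antisym (rootDist _) x⪯y y⪯v))
  Boundary-upward (inj₂ (_ , w , v⪯w , x~w)) x⪯y y⪯v | no _   =
    inj₂ (x⪯y , w , Anc-trans y⪯v v⪯w , x~w)

  path-to-Boundary : ∀ {v x} → Boundary G parent v x →
                     Σ (Walk parentGraph (suc v) (suc x)) λ p → All (λ t → x ∈ₛ bag t) (verts p)
  path-to-Boundary {v} {x} b = walkDown (Anc-suc⁺ (Boundary⇒Anc b)) ,
                               All.map in-bag (walkDown-between (Anc-suc⁺ (Boundary⇒Anc b)))
    where
    in-bag : ∀ {t} → Anc parentᵀ (suc x) t × Anc parentᵀ t (suc v) → x ∈ₛ bag t
    in-bag {zero}  (x⪯0 , _) with Tᶠ.Anc-root x⪯0 refl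
    ... | ()
    in-bag {suc y} (x⪯y , y⪯v) = ∈-subsetOf⁺ (Boundary? y) (Boundary-upward b (Anc-suc⁻ x⪯y) (Anc-suc⁻ y⪯v))

  connectedBags : ∀ x → ConnectedSet parentGraph (λ t → x ∈ₛ bag t)
  connectedBags x zero    _       x∈ _   = ⊥-elim (∉∅ x∈)
  connectedBags x (suc _) zero    _  x∈ = ⊥-elim (∉∅ x∈)
  connectedBags x (suc a) (suc b) x∈a x∈b
    with path-to-Boundary (∈-subsetOf⁻ (Boundary? a) x∈a) | path-to-Boundary (∈-subsetOf⁻ (Boundary? b) x∈b)
  ... | p , x∈p | q , x∈q = p ++ᵂ reverseᵂ q , All-++ᵂ p (reverseᵂ q) x∈p (All-reverseᵂ q x∈q)

  edgeCover : ∀ x y → E G x y → ∃ λ t → x ∈ₛ bag t × y ∈ₛ bag t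
  edgeCover x y e with edgeAnc x y e
  ... | inj₁ x⪯y = suc y , ∈-subsetOf⁺ (Boundary? y) (inj₂ (x⪯y , y , here , e)) ,
                           ∈-subsetOf⁺ (Boundary? y) (inj₁ refl)
  ... | inj₂ y⪯x = suc x , ∈-subsetOf⁺ (Boundary? x) (inj₁ refl) ,
                           ∈-subsetOf⁺ (Boundary? x) (inj₂ (y⪯x , x , here , Walks.E-sym G e))

  decomposition : TreeDecomposition G
  decomposition = record
    { T             = parentGraph
    ; isTree        = connected zero zero⪯ , acyclic
    ; bag           = bag
    ; vertexCover   = λ x → suc x , ∈-subsetOf⁺ (Boundary? x) (inj₁ refl)
    ; edgeCover     = edgeCover
    ; connectedBags = connectedBags }

  width : WidthAtMost decomposition (k ∸ 1)
  width zero    = subst (_≤ _) (sym (∣⊥∣≡0 n)) z≤n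
  width (suc v) = ℕₚ.≤-trans
    (∣p∣≤k (bag (suc v)) (slot v) (λ x∈ → slot-covers v _ (∈-subsetOf⁻ (Boundary? v) x∈)))
    (ℕₚ.m≤n+m∸n k 1)

  depth : DepthAtMost decomposition q
  depth = zero , ancestorBags
    where
    ancestorBags : ∀ t → ∃ λ (U : Subset n) → ∣ U ∣ ≤ q ×
                   (∀ s x → Ancestor parentGraph zero s t → x ∈ₛ bag s → x ∈ₛ U)
    ancestorBags zero = ∅ , subst (_≤ q) (sym (∣⊥∣≡0 n)) z≤n , nothing-above-root
      where
      nothing-above-root : ∀ s x → Ancestor parentGraph zero s zero → x ∈ₛ bag s → x ∈ₛ ∅
      nothing-above-root zero    _ _   x∈ = x∈
      nothing-above-root (suc s) _ s⪯0 _ with Tᶠ.Anc-root (Ancestor⇒Anc refl s⪯0) refl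
      ... | ()
    ancestorBags (suc v) = subsetOf (Anc? (rootDist v)) , ancestors-few , ancestors-cover
      where
      ancestors-few : ∣ subsetOf (Anc? (rootDist v)) ∣ ≤ q
      ancestors-few = ℕₚ.≤-trans
        (∣p∣≤length _ (λ x∈ → ∈-pathToRoot⁺ (rootDist v) (∈-subsetOf⁻ (Anc? (rootDist v)) x∈)))
        (subst (_≤ q) (sym (length-pathToRoot (rootDist v))) (proj₂ (proj₂ (depth≤ v))))
      ancestors-cover : ∀ s x → Ancestor parentGraph zero s (suc v) → x ∈ₛ bag s →
                        x ∈ₛ subsetOf (Anc? (rootDist v))
      ancestors-cover zero    _ _   x∈ = ⊥-elim (∉∅ x∈)
      ancestors-cover (suc s) _ s⪯v x∈ = ∈-subsetOf⁺ (Anc? (rootDist v))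
        (Anc-trans (Boundary⇒Anc (∈-subsetOf⁻ (Boundary? s) x∈)) (Anc-suc⁻ (Ancestor⇒Anc refl s⪯v)))

slotForestCover⇒treeDecomposition : ∀ {k q G} → SlotForestCover k q G → HasTreeDecomposition k q G
slotForestCover⇒treeDecomposition F = decomposition , width , depth
  where open ToTreeDecomposition F

module ToPebbleForestCover {k q : ℕ} {G : Graph} (F : SlotForestCover k q G) where

  open SlotForestCover F
  open Forest parent

  selfSlot : V G → Fin k
  selfSlot v = proj₁ (slot-covers v v (inj₁ refl))

  blocked : (V G → Fin k) → V G → Fin k → Maybe (Fin k)
  blocked colour v ℓ with ℓ Fin.≟ selfSlot v
  ... | yes _ = nothing
  ... | no  _ = Maybe.map colour (slot v ℓ)

  blocked-self : ∀ colour v → blocked colour v (selfSlot v) ≡ nothing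
  blocked-self colour v with selfSlot v Fin.≟ selfSlot v
  ... | yes _ = refl
  ... | no ≢  = ⊥-elim (≢ refl)

  blocked-other : ∀ colour v {ℓ} → ℓ ≢ selfSlot v → blocked colour v ℓ ≡ Maybe.map colour (slot v ℓ)
  blocked-other colour v {ℓ} ℓ≢ with ℓ Fin.≟ selfSlot v
  ... | yes ≡ = ⊥-elim (ℓ≢ ≡)
  ... | no  _ = refl

  freeColour : (V G → Fin k) → V G → Fin k
  freeColour colour v = proj₁ (∃-missedValue (blocked colour v) {selfSlot v} (blocked-self colour v))

  freeColour-free : ∀ colour v ℓ → blocked colour v ℓ ≢ just (freeColour colour v)
  freeColour-free colour v = proj₂ (∃-missedValue (blocked colour v) {selfSlot v} (blocked-self colour v))

  -- The pebbles of v and all its ancestors, assigned from the root down.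
  colouring : ∀ {v m} → RootDist parent v m → V G → Fin k
  colouring {v} (root _)   _ = selfSlot v
  colouring {v} (step _ d)   = updateAt (colouring d) v (λ _ → freeColour (colouring d) v)

  pebble : V G → Fin k
  pebble v = colouring (rootDist v) v

  colouring-irrelevant : ∀ {v m m′} (d : RootDist parent v m) (d′ : RootDist parent v m′) →
                         colouring d ≡ colouring d′
  colouring-irrelevant d d′ with RootDist-functional d d′
  ... | refl = cong colouring (RootDist-irrelevant d d′)

  colouring-consistent : ∀ {u v m} (d : RootDist parent v m) → Anc parent u v → colouring d u ≡ pebble u
  colouring-consistent {u} {v} d u⪯v with u Fin.≟ v
  ... | yes refl = cong (λ colour → colour u) (colouring-irrelevant d (rootDist u))
  colouring-consistent (root e)   u⪯v | no u≢v = ⊥-elim (u≢v (Anc-root u⪯v e))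
  colouring-consistent {u} {v} (step e d) u⪯v | no u≢v =
    trans (updateAt-minimal u v (colouring d) u≢v) (colouring-consistent d (Anc-parent u⪯v u≢v e))

  separated : ∀ {u w v m} (d : RootDist parent w m) → E G u v → Anc parent u w → u ≢ w → Anc parent w v →
              colouring d w ≢ pebble u
  separated (root e) _ u⪯w u≢w _ = ⊥-elim (u≢w (Anc-root u⪯w e))
  separated {u} {w} {v} (step e d) u~v u⪯w u≢w w⪯v same with slot-covers w u (inj₂ (u⪯w , v , w⪯v , u~v))
  ... | ℓ , ℓ↦u = freeColour-free (colouring d) w ℓ (begin
      blocked (colouring d) w ℓ               ≡⟨ blocked-other (colouring d) w ℓ≢self ⟩
      Maybe.map (colouring d) (slot w ℓ) ≡⟨ cong (Maybe.map (colouring d)) ℓ↦u ⟩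
      just (colouring d u)                    ≡⟨ cong just (colouring-consistent d (Anc-parent u⪯w u≢w e)) ⟩
      just (pebble u)                         ≡⟨ cong just (sym same) ⟩
      just (colouring (step e d) w)           ≡⟨ cong just (updateAt-updates w (colouring d)) ⟩
      just (freeColour (colouring d) w)       ∎)
    where
    open ≡-Reasoning
    ℓ≢self : ℓ ≢ selfSlot w
    ℓ≢self ℓ≡self = u≢w (Maybeₚ.just-injective (trans (sym ℓ↦u)
                      (trans (cong (slot w) ℓ≡self) (proj₂ (slot-covers w w (inj₁ refl))))))

  cover : PebbleForestCover k G
  cover = record
    { parent   = parent
    ; pebble   = pebble
    ; isForest = λ v → _ , rootDist v
    ; edgeAnc  = edgeAnc
    ; pebbling = λ u v w u~v _ _ u⪯w u≢w w⪯v same → separated (rootDist w) u~v u⪯w u≢w w⪯v (sym same) }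

slotForestCover⇒pebbleForestCover : ∀ {k q G} → SlotForestCover k q G → HasPebbleForestCover k q G
slotForestCover⇒pebbleForestCover {q = q} F = cover , λ v m d →
  subst (_≤ q) (Forest.RootDist-functional parent (rootDist v) d) (proj₂ (proj₂ (depth≤ v)))
  where
  open SlotForestCover F
  open ToPebbleForestCover F

-- Construction trees yield slot forest covers

Labelled : ∀ {k} (H : LGraph k) → LV H → Set
Labelled H v = ∃ λ ℓ → label H ℓ ≡ just v

Labelled? : ∀ {k} (H : LGraph k) → ∀ v → Dec (Labelled H v)
Labelled? H v = any? (λ ℓ → Maybeₚ.≡-dec Fin._≟_ (label H ℓ) (just v))

-- The boundary of v when the labelled vertices L count as common ancestors of everything.
BoundaryL : (G : Graph) → (V G → Set) → (V G → Maybe (V G)) → V G → V G → Set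
BoundaryL G L par v u = u ≡ v ⊎ ((L u ⊎ Anc par u v) × ∃ λ w → Anc par v w × E G u w)

-- The invariant along a construction tree: a slot forest cover of the unlabelled vertices.
record LabelledCover (k : ℕ) (G : Graph) (L : V G → Set) (e : ℕ) : Set where
  field
    parent            : V G → Maybe (V G)
    labelled-root     : ∀ v → L v → parent v ≡ nothing
    parent-unlabelled : ∀ v w → parent v ≡ just w → ¬ L w
    depth≤            : ∀ v → ¬ L v → ∃ λ m → RootDist parent v m × m ≤ e
    edgeAnc           : ∀ u v → E G u v → ¬ L u → ¬ L v → Anc parent u v ⊎ Anc parent v u
    slot              : V G → Fin k → Maybe (V G)
    slot-covers       : ∀ v u → ¬ L v → BoundaryL G L parent v u → ∃ λ ℓ → slot v ℓ ≡ just u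

module _ {k : ℕ} where

  leafCover : ∀ (G : Graph) (L : V G → Set) → (∀ v → L v) → LabelledCover k G L 0
  leafCover G L all = record
    { parent            = λ _ → nothing
    ; labelled-root     = λ _ _ → refl
    ; parent-unlabelled = λ _ _ ()
    ; depth≤            = λ v v∉L → ⊥-elim (v∉L (all v))
    ; edgeAnc           = λ u _ _ u∉L _ → ⊥-elim (u∉L (all u))
    ; slot              = λ _ _ → nothing
    ; slot-covers       = λ v _ v∉L _ → ⊥-elim (v∉L (all v)) }

  LabelledCover-mono : ∀ {G L e e′} → e ≤ e′ → LabelledCover k G L e → LabelledCover k G L e′
  LabelledCover-mono e≤e′ C = record
    { parent = parent ; labelled-root = labelled-root ; parent-unlabelled = parent-unlabelled
    ; depth≤ = λ v v∉L → Product.map₂ (Product.map₂ (λ m≤e → ℕₚ.≤-trans m≤e e≤e′)) (depth≤ v v∉L)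
    ; edgeAnc = edgeAnc ; slot = slot ; slot-covers = slot-covers }
    where open LabelledCover C

  LabelledCover-resp : ∀ {G L₁ L₂ e} → (∀ v → L₁ v → L₂ v) → (∀ v → L₂ v → L₁ v) →
                       LabelledCover k G L₁ e → LabelledCover k G L₂ e
  LabelledCover-resp {G} {L₁} {L₂} L₁⊆L₂ L₂⊆L₁ C = record
    { parent            = parent
    ; labelled-root     = λ v v∈L → labelled-root v (L₂⊆L₁ v v∈L)
    ; parent-unlabelled = λ v w e w∈L → parent-unlabelled v w e (L₂⊆L₁ w w∈L)
    ; depth≤            = λ v v∉L → depth≤ v (v∉L ∘ L₁⊆L₂ v)
    ; edgeAnc           = λ u v e u∉L v∉L → edgeAnc u v e (u∉L ∘ L₁⊆L₂ u) (v∉L ∘ L₁⊆L₂ v)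
    ; slot              = slot
    ; slot-covers       = λ v u v∉L b → slot-covers v u (v∉L ∘ L₁⊆L₂ v) (boundary b) }
    where
    open LabelledCover C
    boundary : ∀ {v u} → BoundaryL G L₂ parent v u → BoundaryL G L₁ parent v u
    boundary (inj₁ u≡v)          = inj₁ u≡v
    boundary (inj₂ (u∈L⊎u⪯v , r)) = inj₂ (Sum.map₁ (L₂⊆L₁ _) u∈L⊎u⪯v , r)

  module TransportCover (G₁ G : Graph) (L₁ : V G₁ → Set) (L : V G → Set)
                   (f : V G₁ → V G) (g : V G → V G₁)
                   (gf : ∀ x → g (f x) ≡ x) (fg : ∀ y → f (g y) ≡ y)
                   (adj≡ : ∀ u v → Graph.adj G (f u) (f v) ≡ Graph.adj G₁ u v)
                   (L₁⇒L : ∀ v → L₁ v → L (f v)) (L⇒L₁ : ∀ v → L (f v) → L₁ v) where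

    L⇒L₁-g : ∀ a → L a → L₁ (g a)
    L⇒L₁-g a a∈L = L⇒L₁ (g a) (subst L (sym (fg a)) a∈L)

    L₁⇒L-g : ∀ a → L₁ (g a) → L a
    L₁⇒L-g a ga∈L₁ = subst L (fg a) (L₁⇒L (g a) ga∈L₁)

    E-g : ∀ {a b} → E G a b → E G₁ (g a) (g b)
    E-g {a} {b} e = trans (sym (adj≡ (g a) (g b)))
                          (subst₂ (λ x y → Graph.adj G x y ≡ true) (sym (fg a)) (sym (fg b)) e)

    module _ {e : ℕ} (C : LabelledCover k G₁ L₁ e) where

      open LabelledCover C renaming (parent to parent₁)

      parentᶠ : V G → Maybe (V G)
      parentᶠ a = Maybe.map f (parent₁ (g a))

      parentᶠ-f : ∀ {v w} → parent₁ v ≡ just w → parentᶠ (f v) ≡ just (f w)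
      parentᶠ-f {v} e = cong (Maybe.map f) (trans (cong parent₁ (gf v)) e)

      Anc-f : ∀ {u v} → Anc parent₁ u v → Anc parentᶠ (f u) (f v)
      Anc-f here       = here
      Anc-f (up e u⪯w) = up (parentᶠ-f e) (Anc-f u⪯w)

      Anc-g : ∀ {a b} → Anc parentᶠ a b → Anc parent₁ (g a) (g b)
      Anc-g here = here
      Anc-g (up e a⪯c) with map-≡-just f e
      ... | w , e′ , refl = up (trans e′ (cong just (sym (gf w)))) (Anc-g a⪯c)

      Anc-fg : ∀ {a b} → Anc parent₁ (g a) (g b) → Anc parentᶠ a b
      Anc-fg {a} {b} ga⪯gb = subst₂ (Anc parentᶠ) (fg a) (fg b) (Anc-f ga⪯gb)

      RootDist-f : ∀ {v m} → RootDist parent₁ v m → RootDist parentᶠ (f v) m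
      RootDist-f {v} (root e)   = root (cong (Maybe.map f) (trans (cong parent₁ (gf v)) e))
      RootDist-f     (step e d) = step (parentᶠ-f e) (RootDist-f d)

      boundary-g : ∀ {a b} → BoundaryL G L parentᶠ a b → BoundaryL G₁ L₁ parent₁ (g a) (g b)
      boundary-g (inj₁ refl) = inj₁ refl
      boundary-g {b = b} (inj₂ (b∈L⊎b⪯a , w , a⪯w , b~w)) =
        inj₂ (Sum.map (L⇒L₁-g b) Anc-g b∈L⊎b⪯a , g w , Anc-g a⪯w , E-g b~w)

      transported : LabelledCover k G L e
      transported = record
        { parent            = parentᶠ
        ; labelled-root     = λ a a∈L → cong (Maybe.map f) (labelled-root (g a) (L⇒L₁-g a a∈L))
        ; parent-unlabelled = λ a b e b∈L → let (w , e₁ , e₂) = map-≡-just f e in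
                                parent-unlabelled (g a) w e₁ (subst L₁ (trans (cong g (sym e₂)) (gf w)) (L⇒L₁-g b b∈L))
        ; depth≤            = λ a a∉L → let (m , d , m≤e) = depth≤ (g a) (a∉L ∘ L₁⇒L-g a) in
                                m , subst (λ z → RootDist parentᶠ z m) (fg a) (RootDist-f d) , m≤e
        ; edgeAnc           = λ a b e a∉L b∉L → Sum.map Anc-fg Anc-fg
                                (edgeAnc (g a) (g b) (E-g e) (a∉L ∘ L₁⇒L-g a) (b∉L ∘ L₁⇒L-g b))
        ; slot              = λ a ℓ → Maybe.map f (slot (g a) ℓ)
        ; slot-covers       = λ a b a∉L bd → let (ℓ , e) = slot-covers (g a) (g b) (a∉L ∘ L₁⇒L-g a) (boundary-g bd) in
                                ℓ , trans (cong (Maybe.map f) e) (cong just (fg b)) }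

  -- x loses its last label and becomes the new root above all unlabelled roots; the labels
  -- of the old graph serve as its slots, as its boundary now consists of labelled vertices.
  module UnlabelCover (G : Graph) (L₁ L₂ : V G → Set) (L₁? : ∀ v → Dec (L₁ v)) (x : V G) (x∈L₁ : L₁ x)
                 (L₂⊆L₁ : ∀ v → L₂ v → L₁ v) (x∉L₂ : ∀ v → L₂ v → v ≢ x)
                 (L₁⊆L₂ : ∀ v → L₁ v → v ≢ x → L₂ v)
                 (labels : Fin k → Maybe (V G)) (labels-cover : ∀ v → L₁ v → ∃ λ ℓ → labels ℓ ≡ just v)
                 {e : ℕ} (C : LabelledCover k G L₁ e) where

    open LabelledCover C renaming (parent to parent₁; depth≤ to depth₁≤; edgeAnc to edgeAnc₁;
                                   slot to slot₁; slot-covers to slot₁-covers)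

    parent₂ : V G → Maybe (V G)
    parent₂ v with v Fin.≟ x | parent₁ v | L₁? v
    ... | yes _ | _       | _     = nothing
    ... | no _  | just w  | _     = just w
    ... | no _  | nothing | yes _ = nothing
    ... | no _  | nothing | no _  = just x

    parent₂-x : parent₂ x ≡ nothing
    parent₂-x with x Fin.≟ x | parent₁ x | L₁? x
    ... | yes _   | _ | _ = refl
    ... | no x≢x | _ | _ = ⊥-elim (x≢x refl)

    parent₂-inherited : ∀ {v w} → v ≢ x → parent₁ v ≡ just w → parent₂ v ≡ just w
    parent₂-inherited {v} v≢x e with v Fin.≟ x | parent₁ v | L₁? v
    parent₂-inherited v≢x _    | yes v≡x | _      | _ = ⊥-elim (v≢x v≡x)
    parent₂-inherited _   refl | no _    | just _ | _ = refl

    parent₂-adopted : ∀ {v} → v ≢ x → parent₁ v ≡ nothing → ¬ L₁ v → parent₂ v ≡ just x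
    parent₂-adopted {v} v≢x e v∉L₁ with v Fin.≟ x | parent₁ v | L₁? v
    parent₂-adopted v≢x _    _    | yes v≡x | _       | _       = ⊥-elim (v≢x v≡x)
    parent₂-adopted _   refl v∉L₁ | no _    | nothing | yes v∈L₁ = ⊥-elim (v∉L₁ v∈L₁)
    parent₂-adopted _   refl _    | no _    | nothing | no _    = refl

    parent₂-labelled : ∀ {v} → v ≢ x → L₁ v → parent₂ v ≡ nothing
    parent₂-labelled {v} v≢x v∈L₁ with v Fin.≟ x | parent₁ v | L₁? v | labelled-root v v∈L₁
    ... | yes v≡x | _       | _        | _ = ⊥-elim (v≢x v≡x)
    ... | no _    | nothing | yes _    | _ = refl
    ... | no _    | nothing | no v∉L₁ | _ = ⊥-elim (v∉L₁ v∈L₁)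

    parent₂-cases : ∀ {v w} → parent₂ v ≡ just w →
                    v ≢ x × (parent₁ v ≡ just w ⊎ parent₁ v ≡ nothing × ¬ L₁ v × w ≡ x)
    parent₂-cases {v} e with v Fin.≟ x | parent₁ v | L₁? v
    parent₂-cases ()   | yes _   | _       | _
    parent₂-cases refl | no v≢x | just _  | _       = v≢x , inj₁ refl
    parent₂-cases ()   | no _    | nothing | yes _
    parent₂-cases refl | no v≢x | nothing | no v∉L₁ = v≢x , inj₂ (refl , v∉L₁ , refl)

    ∉L₁⇒≢x : ∀ {v} → ¬ L₁ v → v ≢ x
    ∉L₁⇒≢x v∉L₁ refl = v∉L₁ x∈L₁

    ∉L₂⇒∉L₁ : ∀ {v} → ¬ L₂ v → v ≢ x → ¬ L₁ v
    ∉L₂⇒∉L₁ v∉L₂ v≢x v∈L₁ = v∉L₂ (L₁⊆L₂ _ v∈L₁ v≢x)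

    Anc₁⇒Anc₂ : ∀ {u v} → Anc parent₁ u v → ¬ L₁ v → Anc parent₂ u v
    Anc₁⇒Anc₂ here       _    = here
    Anc₁⇒Anc₂ (up e u⪯w) v∉L₁ =
      up (parent₂-inherited (∉L₁⇒≢x v∉L₁) e) (Anc₁⇒Anc₂ u⪯w (parent-unlabelled _ _ e))

    Anc₂⇒Anc₁ : ∀ {u v} → Anc parent₂ u v → u ≡ x ⊎ Anc parent₁ u v
    Anc₂⇒Anc₁ here = inj₂ here
    Anc₂⇒Anc₁ (up e u⪯w) with parent₂-cases e | Anc₂⇒Anc₁ u⪯w
    ... | _ , inj₁ e₁             | inj₁ u≡x  = inj₁ u≡x
    ... | _ , inj₁ e₁             | inj₂ u⪯₁w = inj₂ (up e₁ u⪯₁w)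
    ... | _ , inj₂ (_ , _ , refl) | _         = inj₁ (Forest.Anc-root parent₂ u⪯w parent₂-x)

    RootDist₁⇒₂ : ∀ {v m} → RootDist parent₁ v m → ¬ L₁ v → RootDist parent₂ v (suc m)
    RootDist₁⇒₂ (root e)   v∉L₁ = step (parent₂-adopted (∉L₁⇒≢x v∉L₁) e v∉L₁) (root parent₂-x)
    RootDist₁⇒₂ (step e d) v∉L₁ =
      step (parent₂-inherited (∉L₁⇒≢x v∉L₁) e) (RootDist₁⇒₂ d (parent-unlabelled _ _ e))

    x⪯ : ∀ v → ¬ L₂ v → Anc parent₂ x v
    x⪯ v v∉L₂ with v Fin.≟ x
    ... | yes refl = here
    ... | no v≢x = go (proj₁ (proj₂ (depth₁≤ v (∉L₂⇒∉L₁ v∉L₂ v≢x)))) (∉L₂⇒∉L₁ v∉L₂ v≢x)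
      where
      go : ∀ {v m} → RootDist parent₁ v m → ¬ L₁ v → Anc parent₂ x v
      go (root e)   v∉L₁ = up (parent₂-adopted (∉L₁⇒≢x v∉L₁) e v∉L₁) here
      go (step e d) v∉L₁ = up (parent₂-inherited (∉L₁⇒≢x v∉L₁) e) (go d (parent-unlabelled _ _ e))

    slot₂ : V G → Fin k → Maybe (V G)
    slot₂ v with v Fin.≟ x
    ... | yes _ = labels
    ... | no _  = slot₁ v

    slot₂-covers : ∀ v u → ¬ L₂ v → BoundaryL G L₂ parent₂ v u → ∃ λ ℓ → slot₂ v ℓ ≡ just u
    slot₂-covers v u v∉L₂ b with v Fin.≟ x
    ... | yes refl = labels-cover u (labelled b)
      where
      labelled : BoundaryL G L₂ parent₂ x u → L₁ u
      labelled (inj₁ refl)               = x∈L₁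
      labelled (inj₂ (inj₁ u∈L₂ , _))    = L₂⊆L₁ u u∈L₂
      labelled (inj₂ (inj₂ u⪯x , _)) with Forest.Anc-root parent₂ u⪯x parent₂-x
      ... | refl = x∈L₁
    ... | no v≢x = slot₁-covers v u (∉L₂⇒∉L₁ v∉L₂ v≢x) (boundary₁ b)
      where
      boundary₁ : BoundaryL G L₂ parent₂ v u → BoundaryL G L₁ parent₁ v u
      boundary₁ (inj₁ u≡v) = inj₁ u≡v
      boundary₁ (inj₂ (u∈L₂⊎u⪯v , w , v⪯w , u~w)) = inj₂ (above u∈L₂⊎u⪯v , w , v⪯₁w , u~w)
        where
        above : L₂ u ⊎ Anc parent₂ u v → L₁ u ⊎ Anc parent₁ u v
        above (inj₁ u∈L₂) = inj₁ (L₂⊆L₁ u u∈L₂)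
        above (inj₂ u⪯v) with Anc₂⇒Anc₁ u⪯v
        ... | inj₁ refl = inj₁ x∈L₁
        ... | inj₂ u⪯₁v = inj₂ u⪯₁v
        v⪯₁w : Anc parent₁ v w
        v⪯₁w with Anc₂⇒Anc₁ v⪯w
        ... | inj₁ v≡x  = ⊥-elim (v≢x v≡x)
        ... | inj₂ v⪯₁w = v⪯₁w

    unlabelledCover : LabelledCover k G L₂ (suc e)
    unlabelledCover = record
      { parent            = parent₂
      ; labelled-root     = λ v v∈L₂ → parent₂-labelled (x∉L₂ v v∈L₂) (L₂⊆L₁ v v∈L₂)
      ; parent-unlabelled = parent₂-unlabelled
      ; depth≤            = depth₂≤
      ; edgeAnc           = edgeAnc₂
      ; slot              = slot₂
      ; slot-covers       = slot₂-covers }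
      where
      parent₂-unlabelled : ∀ v w → parent₂ v ≡ just w → ¬ L₂ w
      parent₂-unlabelled v w e w∈L₂ with parent₂-cases e
      ... | _ , inj₁ e₁               = parent-unlabelled v w e₁ (L₂⊆L₁ w w∈L₂)
      ... | _ , inj₂ (_ , _ , refl)   = x∉L₂ w w∈L₂ refl
      depth₂≤ : ∀ v → ¬ L₂ v → ∃ λ m → RootDist parent₂ v m × m ≤ suc e
      depth₂≤ v v∉L₂ with v Fin.≟ x
      ... | yes refl = 1 , root parent₂-x , s≤s z≤n
      ... | no v≢x   = let (m , d , m≤e) = depth₁≤ v (∉L₂⇒∉L₁ v∉L₂ v≢x) in
                       suc m , RootDist₁⇒₂ d (∉L₂⇒∉L₁ v∉L₂ v≢x) , s≤s m≤e
      edgeAnc₂ : ∀ u v → E G u v → ¬ L₂ u → ¬ L₂ v → Anc parent₂ u v ⊎ Anc parent₂ v u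
      edgeAnc₂ u v u~v u∉L₂ v∉L₂ with u Fin.≟ x | v Fin.≟ x
      ... | yes refl | _        = inj₁ (x⪯ v v∉L₂)
      ... | no _     | yes refl = inj₂ (x⪯ u u∉L₂)
      ... | no u≢x   | no v≢x   = Sum.map (λ u⪯v → Anc₁⇒Anc₂ u⪯v (∉L₂⇒∉L₁ v∉L₂ v≢x))
                                               (λ v⪯u → Anc₁⇒Anc₂ v⪯u (∉L₂⇒∉L₁ u∉L₂ u≢x))
                                               (edgeAnc₁ u v u~v (∉L₂⇒∉L₁ u∉L₂ u≢x) (∉L₂⇒∉L₁ v∉L₂ v≢x))

  removeLabel : Fin k → LGraph k → LGraph k
  removeLabel ℓ H = record
    { graph = graph H
    ; label = λ ℓ′ → if does (ℓ′ Fin.≟ ℓ) then nothing else label H ℓ′ }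

  label-removeLabel : ∀ {ℓ H ℓ′} → ℓ′ ≢ ℓ → label (removeLabel ℓ H) ℓ′ ≡ label H ℓ′
  label-removeLabel {ℓ} {ℓ′ = ℓ′} ℓ′≢ℓ rewrite dec-false (ℓ′ Fin.≟ ℓ) ℓ′≢ℓ = refl

  label-removeLabel⁻ : ∀ {ℓ H ℓ′ v} → label (removeLabel ℓ H) ℓ′ ≡ just v → ℓ′ ≢ ℓ × label H ℓ′ ≡ just v
  label-removeLabel⁻ {ℓ} {ℓ′ = ℓ′} e with ℓ′ Fin.≟ ℓ
  label-removeLabel⁻ () | yes _
  label-removeLabel⁻ e  | no ℓ′≢ℓ = ℓ′≢ℓ , e

  Labelled-removeLabel⁻ : ∀ {ℓ H} v → Labelled (removeLabel ℓ H) v → Labelled H v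
  Labelled-removeLabel⁻ {ℓ} {H} v (ℓ′ , e) = ℓ′ , proj₂ (label-removeLabel⁻ {ℓ} {H} e)

  Labelled-removeLabel⁺ : ∀ {ℓ H} v → Labelled H v → label H ℓ ≢ just v → Labelled (removeLabel ℓ H) v
  Labelled-removeLabel⁺ {ℓ} {H} v (ℓ′ , e) ℓ↛v with ℓ′ Fin.≟ ℓ
  ... | yes refl = ⊥-elim (ℓ↛v e)
  ... | no ℓ′≢ℓ  = ℓ′ , trans (label-removeLabel {ℓ} {H} ℓ′≢ℓ) e

  removeLabel-cover : ∀ {e} (ℓ : Fin k) (H : LGraph k) → LabelledCover k (graph H) (Labelled H) e →
                      LabelledCover k (graph H) (Labelled (removeLabel ℓ H)) (suc e)
  removeLabel-cover {e} ℓ H C = by-label (label H ℓ) refl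
    where
    L₁ L₂ : V (graph H) → Set
    L₁ = Labelled H
    L₂ = Labelled (removeLabel ℓ H)

    weakened : LabelledCover k (graph H) L₁ (suc e)
    weakened = LabelledCover-mono (ℕₚ.n≤1+n e) C

    L₂⊆L₁ : ∀ v → L₂ v → L₁ v
    L₂⊆L₁ = Labelled-removeLabel⁻ {ℓ} {H}

    L₁⊆L₂ : ∀ v → L₁ v → label H ℓ ≢ just v → L₂ v
    L₁⊆L₂ = Labelled-removeLabel⁺ {ℓ} {H}

    other : ∀ {x v} → label H ℓ ≡ just x → v ≢ x → label H ℓ ≢ just v
    other ℓ↦x v≢x ℓ↦v = v≢x (Maybeₚ.just-injective (trans (sym ℓ↦v) ℓ↦x))

    by-label : ∀ mx → label H ℓ ≡ mx → LabelledCover k (graph H) L₂ (suc e)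
    by-label nothing ℓ↦nothing =
      LabelledCover-resp (λ v v∈L₁ → L₁⊆L₂ v v∈L₁ (λ ℓ↦v → just≢nothing (trans (sym ℓ↦v) ℓ↦nothing))) L₂⊆L₁ weakened
    by-label (just x) ℓ↦x with Labelled? (removeLabel ℓ H) x
    ... | yes x∈L₂ = LabelledCover-resp still-labelled L₂⊆L₁ weakened
      where
      still-labelled : ∀ v → L₁ v → L₂ v
      still-labelled v v∈L₁ with v Fin.≟ x
      ... | yes refl = x∈L₂
      ... | no v≢x   = L₁⊆L₂ v v∈L₁ (other ℓ↦x v≢x)
    ... | no x∉L₂ = UnlabelCover.unlabelledCover (graph H) L₁ L₂ (Labelled? H) x (ℓ , ℓ↦x) L₂⊆L₁
                      (λ v v∈L₂ v≡x → x∉L₂ (subst L₂ v≡x v∈L₂)) (λ v v∈L₁ v≢x → L₁⊆L₂ v v∈L₁ (other ℓ↦x v≢x))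
                      (label H) (λ _ v∈L₁ → v∈L₁) C

  elimination-cover : ∀ {e} {ℓ : Fin k} {H₁ H : LGraph k} → RemoveLabel ℓ H₁ H →
                      LabelledCover k (graph H₁) (Labelled H₁) e → LabelledCover k (graph H) (Labelled H) (suc e)
  elimination-cover {ℓ = ℓ} {H₁} {H} (f , g , gf , fg , adj≡ , ℓ↦nothing , label≡) C =
    TransportCover.transported (graph H₁) (graph H) (Labelled (removeLabel ℓ H₁)) (Labelled H) f g gf fg adj≡
      Labelled-f f-Labelled (removeLabel-cover ℓ H₁ C)
    where
    Labelled-f : ∀ v → Labelled (removeLabel ℓ H₁) v → Labelled H (f v)
    Labelled-f v (ℓ′ , e′) with label-removeLabel⁻ {ℓ} {H₁} e′
    ... | ℓ′≢ℓ , e = ℓ′ , trans (label≡ ℓ′ ℓ′≢ℓ) (cong (Maybe.map f) e)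
    f-Labelled : ∀ v → Labelled H (f v) → Labelled (removeLabel ℓ H₁) v
    f-Labelled v (ℓ′ , e′) with ℓ′ Fin.≟ ℓ
    ... | yes refl = ⊥-elim (just≢nothing (trans (sym e′) ℓ↦nothing))
    ... | no ℓ′≢ℓ with map-≡-just f {label H₁ ℓ′} (trans (sym (label≡ ℓ′ ℓ′≢ℓ)) e′)
    ...   | w , e , fw≡fv = ℓ′ , trans (label-removeLabel {ℓ} {H₁} ℓ′≢ℓ)
                                   (trans e (cong just (trans (sym (gf w)) (trans (cong g fw≡fv) (gf v)))))

  -- Unlabelled vertices of a product come from a single factor, so the factor covers
  -- combine side by side.
  module ProductCover {m : ℕ} (Gs : Fin m → LGraph k) (H : LGraph k) (P : IsProduct Gs H)
                 (es : Fin m → ℕ) (Cs : ∀ i → LabelledCover k (graph (Gs i)) (Labelled (Gs i)) (es i)) where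

    Point : Set
    Point = Σ (Fin m) (λ i → LV (Gs i))

    ι : (i : Fin m) → LV (Gs i) → LV H
    ι = proj₁ P

    ι-surjective : ∀ a → ∃₂ λ i u → ι i u ≡ a
    ι-surjective = proj₁ (proj₂ P)

    ι-identifies : ∀ i u j w → (ι i u ≡ ι j w) ⇔ EqClosure (ShareLabel Gs) (i , u) (j , w)
    ι-identifies = proj₁ (proj₂ (proj₂ P))

    ι-edges : ∀ a b → LE H a b ⇔ (∃ λ i → ∃₂ λ u v → LE (Gs i) u v × ι i u ≡ a × ι i v ≡ b)
    ι-edges = proj₁ (proj₂ (proj₂ (proj₂ P)))

    ι-labels : ∀ ℓ a → label H ℓ ≡ just a ⇔ (∃₂ λ i u → label (Gs i) ℓ ≡ just u × ι i u ≡ a)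
    ι-labels = proj₂ (proj₂ (proj₂ (proj₂ P)))

    module C (i : Fin m) = LabelledCover (Cs i)

    only-shares-labels : ∀ {p q : Point} → (∀ z → ¬ ShareLabel Gs p z) → (∀ z → ¬ ShareLabel Gs z p) →
                         Star (SymClosure (ShareLabel Gs)) p q → p ≡ q
    only-shares-labels _    _    ε              = refl
    only-shares-labels ¬p→ _    (fwd p→z ◅ _) = ⊥-elim (¬p→ _ p→z)
    only-shares-labels _    ¬→p (bwd z→p ◅ _) = ⊥-elim (¬→p _ z→p)

    unlabelled-isolated : ∀ {i u} → ¬ Labelled (Gs i) u → ∀ {j w} → ι i u ≡ ι j w → _≡_ {A = Point} (i , u) (j , w)
    unlabelled-isolated u∉L ιu≡ιw = only-shares-labels
      (λ { _ (ℓ , e , _) → u∉L (ℓ , e) }) (λ { _ (ℓ , _ , e) → u∉L (ℓ , e) })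
      (Equivalence.to (ι-identifies _ _ _ _) ιu≡ιw)

    Labelled-ι : ∀ {i u} → Labelled (Gs i) u → Labelled H (ι i u)
    Labelled-ι {i} {u} (ℓ , e) = ℓ , Equivalence.from (ι-labels ℓ (ι i u)) (i , u , e , refl)

    unlabelled-ι : ∀ {i u} → ¬ Labelled (Gs i) u → ¬ Labelled H (ι i u)
    unlabelled-ι {i} {u} u∉L (ℓ , e) with Equivalence.to (ι-labels ℓ (ι i u)) e
    ... | j , w , e′ , ιw≡ιu with unlabelled-isolated u∉L (sym ιw≡ιu)
    ... | refl = u∉L (ℓ , e′)

    ι⁻¹ : LV H → Point
    ι⁻¹ a = proj₁ (ι-surjective a) , proj₁ (proj₂ (ι-surjective a))

    ι-ι⁻¹ : ∀ a → ι (proj₁ (ι⁻¹ a)) (proj₂ (ι⁻¹ a)) ≡ a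
    ι-ι⁻¹ a = proj₂ (proj₂ (ι-surjective a))

    ι⁻¹-ι : ∀ {i u} → ¬ Labelled (Gs i) u → ι⁻¹ (ι i u) ≡ (i , u)
    ι⁻¹-ι u∉L = sym (unlabelled-isolated u∉L (sym (ι-ι⁻¹ _)))

    unlabelled-preimage : ∀ a → ¬ Labelled H a → ∃₂ λ i u → ι i u ≡ a × ¬ Labelled (Gs i) u
    unlabelled-preimage a a∉L with ι-surjective a
    ... | i , u , refl = i , u , refl , a∉L ∘ Labelled-ι

    parentᴾ : LV H → Maybe (LV H)
    parentᴾ a with Labelled? H a
    ... | yes _ = nothing
    ... | no _  = let (i , u) = ι⁻¹ a in Maybe.map (ι i) (C.parent i u)

    slotᴾ : LV H → Fin k → Maybe (LV H)
    slotᴾ a ℓ = let (i , u) = ι⁻¹ a in Maybe.map (ι i) (C.slot i u ℓ)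

    parentᴾ-ι : ∀ {i u} → ¬ Labelled (Gs i) u → parentᴾ (ι i u) ≡ Maybe.map (ι i) (C.parent i u)
    parentᴾ-ι {i} {u} u∉L with Labelled? H (ι i u)
    ... | yes ιu∈L = ⊥-elim (unlabelled-ι u∉L ιu∈L)
    ... | no _     = cong (λ { (j , w) → Maybe.map (ι j) (C.parent j w) }) (ι⁻¹-ι u∉L)

    slotᴾ-ι : ∀ {i u} ℓ → ¬ Labelled (Gs i) u → slotᴾ (ι i u) ℓ ≡ Maybe.map (ι i) (C.slot i u ℓ)
    slotᴾ-ι ℓ u∉L = cong (λ { (j , w) → Maybe.map (ι j) (C.slot j w ℓ) }) (ι⁻¹-ι u∉L)

    labelled-rootᴾ : ∀ a → Labelled H a → parentᴾ a ≡ nothing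
    labelled-rootᴾ a a∈L with Labelled? H a
    ... | yes _   = refl
    ... | no a∉L = ⊥-elim (a∉L a∈L)

    parentᴾ-unlabelled : ∀ a b → parentᴾ a ≡ just b → ¬ Labelled H b
    parentᴾ-unlabelled a b e with Labelled? H a
    parentᴾ-unlabelled a b () | yes _
    ... | no _ with map-≡-just (ι (proj₁ (ι⁻¹ a))) {C.parent (proj₁ (ι⁻¹ a)) (proj₂ (ι⁻¹ a))} e
    ...   | w , e′ , refl = unlabelled-ι (C.parent-unlabelled _ _ w e′)

    edge-in-factor : ∀ {i u b} → ¬ Labelled (Gs i) u → LE H (ι i u) b → ∃ λ v → LE (Gs i) u v × ι i v ≡ b
    edge-in-factor {i} {u} {b} u∉L e with Equivalence.to (ι-edges (ι i u) b) e
    ... | j , u′ , v , e′ , ιu′≡ιu , ιv≡b with unlabelled-isolated u∉L (sym ιu′≡ιu)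
    ... | refl = v , e′ , ιv≡b

    Anc-ι : ∀ {i u v} → Anc (C.parent i) u v → ¬ Labelled (Gs i) v → Anc parentᴾ (ι i u) (ι i v)
    Anc-ι here           _    = here
    Anc-ι {i} (up e u⪯w) v∉L = up (trans (parentᴾ-ι v∉L) (cong (Maybe.map (ι i)) e))
                                  (Anc-ι u⪯w (C.parent-unlabelled i _ _ e))

    RootDist-ι : ∀ {i v m} → RootDist (C.parent i) v m → ¬ Labelled (Gs i) v → RootDist parentᴾ (ι i v) m
    RootDist-ι {i} (root e)   v∉L = root (trans (parentᴾ-ι v∉L) (cong (Maybe.map (ι i)) e))
    RootDist-ι {i} (step e d) v∉L = step (trans (parentᴾ-ι v∉L) (cong (Maybe.map (ι i)) e))
                                         (RootDist-ι d (C.parent-unlabelled i _ _ e))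

    Anc-ι⁻¹ : ∀ {a b} → Anc parentᴾ a b → ∀ {i v} → ¬ Labelled (Gs i) v → ι i v ≡ b →
              ∃ λ u → Anc (C.parent i) u v × ι i u ≡ a
    Anc-ι⁻¹ here {v = v} _ ιv≡b = v , here , ιv≡b
    Anc-ι⁻¹ (up e a⪯c) {i} {v} v∉L refl with map-≡-just (ι i) (trans (sym (parentᴾ-ι v∉L)) e)
    ... | w , e′ , ιw≡c = Product.map₂ (Product.map₁ (up e′))
                            (Anc-ι⁻¹ a⪯c (C.parent-unlabelled i v w e′) ιw≡c)

    unlabelled-below : ∀ {a w} → Anc parentᴾ a w → ¬ Labelled H a → ¬ Labelled H w
    unlabelled-below here         a∉L = a∉L
    unlabelled-below (up e _) _   w∈L = just≢nothing (trans (sym e) (labelled-rootᴾ _ w∈L))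

    unlabelled-above : ∀ {b a} → Anc parentᴾ b a → ¬ Labelled H a → ¬ Labelled H b
    unlabelled-above here       a∉L = a∉L
    unlabelled-above (up e b⪯w) _   = unlabelled-above b⪯w (parentᴾ-unlabelled _ _ e)

    edgeAnc-ι : ∀ {i u b} → ¬ Labelled (Gs i) u → LE H (ι i u) b → ¬ Labelled H b →
                Anc parentᴾ (ι i u) b ⊎ Anc parentᴾ b (ι i u)
    edgeAnc-ι {i} {u} u∉L e b∉L with edge-in-factor u∉L e
    ... | v , u~v , refl = Sum.map (λ u⪯v → Anc-ι u⪯v (b∉L ∘ Labelled-ι)) (λ v⪯u → Anc-ι v⪯u u∉L)
                                        (C.edgeAnc i u v u~v u∉L (b∉L ∘ Labelled-ι))

    boundary-ι⁻¹ : ∀ {i u b} → ¬ Labelled (Gs i) u → BoundaryL (graph H) (Labelled H) parentᴾ (ι i u) b →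
                   ∃ λ b′ → ι i b′ ≡ b × BoundaryL (graph (Gs i)) (Labelled (Gs i)) (C.parent i) u b′
    boundary-ι⁻¹ {u = u} _ (inj₁ refl) = u , refl , inj₁ refl
    boundary-ι⁻¹ {i} {u} u∉L (inj₂ (b∈L⊎b⪯ιu , w , ιu⪯w , b~w))
      with unlabelled-preimage w (unlabelled-below ιu⪯w (unlabelled-ι u∉L))
    ... | j , w₁ , refl , w₁∉L with Anc-ι⁻¹ ιu⪯w w₁∉L refl
    ...   | u₂ , u₂⪯w₁ , ιu₂≡ιu with unlabelled-isolated u∉L (sym ιu₂≡ιu)
    ...     | refl with edge-in-factor w₁∉L (Walks.E-sym (graph H) b~w)
    ...       | b₁ , w₁~b₁ , refl = b₁ , refl , inj₂ (above b∈L⊎b⪯ιu , w₁ , u₂⪯w₁ , Walks.E-sym (graph (Gs i)) w₁~b₁)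
      where
      above : Labelled H (ι i b₁) ⊎ Anc parentᴾ (ι i b₁) (ι i u) → Labelled (Gs i) b₁ ⊎ Anc (C.parent i) b₁ u
      above (inj₁ ιb₁∈L)  = inj₁ (decidable-stable (Labelled? (Gs i) b₁) (λ b₁∉L → unlabelled-ι b₁∉L ιb₁∈L))
      above (inj₂ ιb₁⪯ιu) with Anc-ι⁻¹ ιb₁⪯ιu u∉L refl
      ... | u₃ , u₃⪯u , ιu₃≡ιb₁ with unlabelled-isolated (u₃∉L u₃ ιu₃≡ιb₁) ιu₃≡ιb₁
        where
        u₃∉L : ∀ u₃ → ι i u₃ ≡ ι i b₁ → ¬ Labelled (Gs i) u₃
        u₃∉L u₃ e u₃∈L = unlabelled-above ιb₁⪯ιu (unlabelled-ι u∉L) (subst (Labelled H) e (Labelled-ι u₃∈L))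
      ...   | refl = inj₂ u₃⪯u

    cover : LabelledCover k (graph H) (Labelled H) (maxF m es)
    cover = record
      { parent            = parentᴾ
      ; labelled-root     = labelled-rootᴾ
      ; parent-unlabelled = parentᴾ-unlabelled
      ; depth≤            = depthᴾ≤
      ; edgeAnc           = edgeAncᴾ
      ; slot              = slotᴾ
      ; slot-covers       = slot-coversᴾ }
      where
      depthᴾ≤ : ∀ a → ¬ Labelled H a → ∃ λ n → RootDist parentᴾ a n × n ≤ maxF m es
      depthᴾ≤ a a∉L with unlabelled-preimage a a∉L
      ... | i , u , refl , u∉L = let (n , d , n≤e) = C.depth≤ i u u∉L in
        n , RootDist-ι d u∉L , ℕₚ.≤-trans n≤e (maxF-upper m es i)
      edgeAncᴾ : ∀ a b → LE H a b → ¬ Labelled H a → ¬ Labelled H b → Anc parentᴾ a b ⊎ Anc parentᴾ b a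
      edgeAncᴾ a b e a∉L b∉L with unlabelled-preimage a a∉L
      ... | i , u , refl , u∉L = edgeAnc-ι u∉L e b∉L
      slot-coversᴾ : ∀ a b → ¬ Labelled H a → BoundaryL (graph H) (Labelled H) parentᴾ a b → ∃ λ ℓ → slotᴾ a ℓ ≡ just b
      slot-coversᴾ a b a∉L b∈∂a with unlabelled-preimage a a∉L
      ... | i , u , refl , u∉L with boundary-ι⁻¹ u∉L b∈∂a
      ...   | b′ , refl , b′∈∂u = Product.map₂ (λ {ℓ} e → trans (slotᴾ-ι ℓ u∉L) (cong (Maybe.map (ι i)) e))
                                    (C.slot-covers i u b′ u∉L b′∈∂u)

  constructionTree-cover : ∀ {H} (t : CTree k H) → LabelledCover k (graph H) (Labelled H) (elimDepth t)
  constructionTree-cover {H} (leaf fullyLabelled) = leafCover (graph H) (Labelled H) fullyLabelled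
  constructionTree-cover (elim _ _ t removal)     = elimination-cover removal (constructionTree-cover t)
  constructionTree-cover {H} (prod m _ Gs ts product) =
    ProductCover.cover Gs H product (λ i → elimDepth (ts i)) (λ i → constructionTree-cover (ts i))

constructionTree⇒slotForestCover : ∀ {k q G} → HasConstructionTree k q G → SlotForestCover k q G
constructionTree⇒slotForestCover {k} {q} {G} (t , depth≤q) = record
  { parent      = parent
  ; depth≤      = λ v → depth≤ v nothing-labelled
  ; edgeAnc     = λ u v e → edgeAnc u v e nothing-labelled nothing-labelled
  ; slot        = slot
  ; slot-covers = λ v u b → slot-covers v u nothing-labelled (Sum.map₂ (Product.map₁ inj₂) b) }
  where
  open LabelledCover (LabelledCover-mono depth≤q (constructionTree-cover t))
  nothing-labelled : ∀ {v} → ¬ Labelled (unlabelled {k} G) v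
  nothing-labelled (_ , ())

-- Tree decompositions yield slot forest covers

-- Each vertex x is attached at the shallowest node top x whose bag contains x. Ordering the
-- vertices by the ancestor order of their tops, with ties broken by index, gives a forest whose
-- root paths lie in the ancestor bags of a node and whose boundaries lie in a single bag.
module FromTreeDecomposition {k q : ℕ} {G : Graph} (k≥1 : 1 ≤ k) (D : TreeDecomposition G)
                             (width≤ : WidthAtMost D (k ∸ 1)) (r : V (TreeDecomposition.T D))
                             (ancestorBags≤ : ∀ v → ∃ λ (U : Subset (Graph.n G)) → ∣ U ∣ ≤ q ×
                               (∀ t x → Ancestor (TreeDecomposition.T D) r t v → x ∈ₛ TreeDecomposition.bag D t → x ∈ₛ U)) where

  open TreeDecomposition D
  open RootedTree T isTree r

  n : ℕ
  n = Graph.n G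

  abstract
    top-spec : ∀ x → ∃ λ t → x ∈ₛ bag t × ∀ s → x ∈ₛ bag s → depth t ≤ depth s
    top-spec x = argminᶠ (λ t → x Subsetₚ.∈? bag t) depth (proj₂ (vertexCover x))

  top : V G → V T
  top x = proj₁ (top-spec x)

  ∈bag-top : ∀ x → x ∈ₛ bag (top x)
  ∈bag-top x = proj₁ (proj₂ (top-spec x))

  top⊑ : ∀ {x t} → x ∈ₛ bag t → top x ⊑ t
  top⊑ {x} = connected-shallowest-⊑ (connectedBags x) (∈bag-top x) (proj₂ (proj₂ (top-spec x)))

  infix 4 _≼_
  _≼_ : V G → V G → Set
  x ≼ y = top x ⊑ top y × (top x ≡ top y → toℕ x ≤ toℕ y)

  _≼?_ : ∀ x y → Dec (x ≼ y)
  x ≼? y = (top x ⊑? top y) ×-dec ((top x Fin.≟ top y) →-dec (toℕ x ℕ.≤? toℕ y))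

  ≼-refl : ∀ x → x ≼ x
  ≼-refl x = ⊑-refl (top x) , λ _ → ℕₚ.≤-refl

  ≼-trans : ∀ {x y z} → x ≼ y → y ≼ z → x ≼ z
  ≼-trans {x} {y} {z} (x⊑y , x≤y) (y⊑z , y≤z) = ⊑-trans x⊑y y⊑z , same-top⇒≤
    where
    same-top⇒≤ : top x ≡ top z → toℕ x ≤ toℕ z
    same-top⇒≤ tx≡tz with ⊑-antisym x⊑y (subst (top y ⊑_) (sym tx≡tz) y⊑z)
    ... | tx≡ty = ℕₚ.≤-trans (x≤y tx≡ty) (y≤z (trans (sym tx≡ty) tx≡tz))

  ⊑⇒≼-total : ∀ x z → top x ⊑ top z → x ≼ z ⊎ z ≼ x
  ⊑⇒≼-total x z x⊑z with top x Fin.≟ top z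
  ... | no tx≢tz = inj₁ (x⊑z , λ tx≡tz → ⊥-elim (tx≢tz tx≡tz))
  ... | yes tx≡tz with toℕ x ℕ.≤? toℕ z
  ...   | yes x≤z = inj₁ (x⊑z , λ _ → x≤z)
  ...   | no x≰z  = inj₂ (subst (_⊑ top x) tx≡tz (⊑-refl (top x)) , λ _ → ℕₚ.<⇒≤ (ℕₚ.≰⇒> x≰z))

  ≼-linear : ∀ {x y z} → x ≼ y → z ≼ y → x ≼ z ⊎ z ≼ x
  ≼-linear {x} {y} {z} (x⊑y , _) (z⊑y , _) with ⊑-linear x⊑y z⊑y
  ... | inj₁ x⊑z = ⊑⇒≼-total x z x⊑z
  ... | inj₂ z⊑x = Sum.swap (⊑⇒≼-total z x z⊑x)

  key : V G → ℕ
  key x = depth (top x) * n + toℕ x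

  ≺⇒key< : ∀ {x y} → x ≼ y → x ≢ y → key x < key y
  ≺⇒key< {x} {y} (x⊑y , x≤y) x≢y with top x Fin.≟ top y
  ... | yes tx≡ty rewrite tx≡ty =
        ℕₚ.+-monoʳ-< (depth (top y) * n) (ℕₚ.≤∧≢⇒< (x≤y refl) (x≢y ∘ toℕ-injective))
  ... | no tx≢ty = begin-strict
        depth (top x) * n + toℕ x   <⟨ ℕₚ.+-monoʳ-< (depth (top x) * n) (toℕ<n x) ⟩
        depth (top x) * n + n       ≡⟨ ℕₚ.+-comm (depth (top x) * n) n ⟩
        suc (depth (top x)) * n     ≤⟨ ℕₚ.*-monoˡ-≤ n depth< ⟩
        depth (top y) * n           ≤⟨ ℕₚ.m≤m+n (depth (top y) * n) (toℕ y) ⟩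
        key y                       ∎
    where
    open ℕₚ.≤-Reasoning
    depth< : depth (top x) < depth (top y)
    depth< = ℕₚ.≤∧≢⇒< (⊑⇒depth≤ x⊑y) (λ eq → tx≢ty (⊑∧depth≥⇒≡ x⊑y (ℕₚ.≤-reflexive (sym eq))))

  Below : V G → V G → Set
  Below y x = x ≼ y × x ≢ y

  Below? : ∀ y x → Dec (Below y x)
  Below? y x = (x ≼? y) ×-dec ¬? (x Fin.≟ y)

  abstract
    parent : V G → Maybe (V G)
    parent y with argmaxᶠ (Below? y) key
    ... | inj₁ (z , _) = just z
    ... | inj₂ _       = nothing

    parent-spec : ∀ y → (∃ λ z → parent y ≡ just z × Below y z × ∀ s → Below y s → key s ≤ key z) ⊎
                        (parent y ≡ nothing × ∀ s → ¬ Below y s)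
    parent-spec y with argmaxᶠ (Below? y) key
    ... | inj₁ (z , z<y , maximal) = inj₁ (z , refl , z<y , maximal)
    ... | inj₂ none                = inj₂ (refl , none)

  Anc⇒≼ : ∀ {x y} → Anc parent x y → x ≼ y
  Anc⇒≼ {x} here = ≼-refl x
  Anc⇒≼ {y = y} (up e x⪯z) with parent-spec y
  ... | inj₁ (_ , e′ , (z≼y , _) , _) rewrite Maybeₚ.just-injective (trans (sym e) e′) = ≼-trans (Anc⇒≼ x⪯z) z≼y
  ... | inj₂ (e′ , _) = ⊥-elim (just≢nothing (trans (sym e) e′))

  ≼⇒Anc-acc : ∀ {x y} → Acc _<_ (key y) → x ≼ y → Anc parent x y
  ≼⇒Anc-acc {x} {y} (acc smaller) x≼y with x Fin.≟ y
  ... | yes refl = here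
  ... | no x≢y with parent-spec y
  ...   | inj₂ (_ , nothing-below) = ⊥-elim (nothing-below x (x≼y , x≢y))
  ...   | inj₁ (z , y→z , (z≼y , z≢y) , maximal) = up y→z (≼⇒Anc-acc (smaller (≺⇒key< z≼y z≢y)) x≼z)
    where
    x≼z : x ≼ z
    x≼z with ≼-linear x≼y z≼y
    ... | inj₁ x≼z = x≼z
    ... | inj₂ z≼x with z Fin.≟ x
    ...   | yes refl = ≼-refl x
    ...   | no z≢x   = ⊥-elim (ℕₚ.<-irrefl refl (ℕₚ.<-≤-trans (≺⇒key< z≼x z≢x) (maximal x (x≼y , x≢y))))

  ≼⇒Anc : ∀ {x y} → x ≼ y → Anc parent x y
  ≼⇒Anc {y = y} = ≼⇒Anc-acc (<-wellFounded (key y))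

  rootDist : ∀ y → Acc _<_ (key y) → ∃ λ m → RootDist parent y m
  rootDist y (acc smaller) with parent-spec y
  ... | inj₂ (y-root , _) = 1 , root y-root
  ... | inj₁ (z , y→z , (z≼y , z≢y) , _) = Product.map suc (step y→z) (rootDist z (smaller (≺⇒key< z≼y z≢y)))

  forestDepth≤ : ∀ v → ∃ λ m → RootDist parent v m × m ≤ q
  forestDepth≤ v with rootDist v (<-wellFounded (key v)) | ancestorBags≤ (top v)
  ... | m , d | U , ∣U∣≤q , U-covers = m , d , ℕₚ.≤-trans (subst (_≤ ∣ U ∣) (length-pathToRoot d) path≤U) ∣U∣≤q
    where
    open Forest parent
    path≤U : length (pathToRoot d) ≤ ∣ U ∣
    path≤U = length≤∣p∣ U (pathToRoot-unique d)
      (λ {u} u∈ → U-covers (top u) u (⊑⇒Ancestor (proj₁ (Anc⇒≼ (∈-pathToRoot⁻ d u∈)))) (∈bag-top u))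

  edgeAnc : ∀ u v → E G u v → Anc parent u v ⊎ Anc parent v u
  edgeAnc u v e with edgeCover u v e
  ... | t , u∈t , v∈t = Sum.map ≼⇒Anc ≼⇒Anc (≼-total (⊑-linear (top⊑ u∈t) (top⊑ v∈t)))
    where
    ≼-total : top u ⊑ top v ⊎ top v ⊑ top u → u ≼ v ⊎ v ≼ u
    ≼-total (inj₁ u⊑v) = ⊑⇒≼-total u v u⊑v
    ≼-total (inj₂ v⊑u) = Sum.swap (⊑⇒≼-total v u v⊑u)

  -- u ⪯ v ⪯ w with u ~ w: top v lies between top u and a node containing both u and w.
  Boundary⇒∈bag-top : ∀ {v u} → Boundary G parent v u → u ∈ₛ bag (top v)
  Boundary⇒∈bag-top (inj₁ refl) = ∈bag-top _
  Boundary⇒∈bag-top {v} {u} (inj₂ (u⪯v , w , v⪯w , u~w)) with edgeCover u w u~w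
  ... | t , u∈t , w∈t = connected-convex (connectedBags u) (∈bag-top u) u∈t
                          (proj₁ (Anc⇒≼ u⪯v)) (⊑-trans (proj₁ (Anc⇒≼ v⪯w)) (top⊑ w∈t))

  cover : SlotForestCover k q G
  cover = record
    { parent      = parent
    ; depth≤      = forestDepth≤
    ; edgeAnc     = edgeAnc
    ; slot        = λ v → enumerate (elements (bag (top v)))
    ; slot-covers = λ v u b →
        ∈⇒enumerated (∈-elements⁺ (bag (top v)) (Boundary⇒∈bag-top b)) (bag-small (top v)) }
    where
    bag-small : ∀ t → length (elements (bag t)) ≤ k
    bag-small t = subst (_≤ k) (sym (length-elements (bag t)))
                        (subst (∣ bag t ∣ ≤_) (ℕₚ.m+[n∸m]≡n k≥1) (width≤ t))

treeDecomposition⇒slotForestCover : ∀ {k q G} → 1 ≤ k → HasTreeDecomposition k q G → SlotForestCover k q G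
treeDecomposition⇒slotForestCover k≥1 (D , width≤ , r , ancestorBags≤) =
  FromTreeDecomposition.cover k≥1 D width≤ r ancestorBags≤

-- A piece of G: the vertices of Vertex with the edges of G having an end in Centre, and labels.
module Pieces (G : Graph) (k : ℕ) where

  n : ℕ
  n = Graph.n G

  record Piece : Set₁ where
    field
      Vertex     : Fin n → Set
      Vertex?    : Decidable Vertex
      Centre     : Fin n → Set
      Centre?    : Decidable Centre
      lab        : Fin k → Maybe (Fin n)
      lab-Vertex : ∀ {ℓ x} → lab ℓ ≡ just x → Vertex x

  open Piece public

  relabel : (σ : Piece) (lab′ : Fin k → Maybe (Fin n)) → (∀ {ℓ x} → lab′ ℓ ≡ just x → Vertex σ x) → Piece
  relabel σ lab′ lab′-Vertex = record σ { lab = lab′ ; lab-Vertex = lab′-Vertex }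

  Edge : Piece → Fin n → Fin n → Set
  Edge σ a b = Vertex σ a × Vertex σ b × (Centre σ a ⊎ Centre σ b) × E G a b

  Edge? : ∀ σ a b → Dec (Edge σ a b)
  Edge? σ a b = Vertex? σ a ×-dec Vertex? σ b ×-dec (Centre? σ a ⊎-dec Centre? σ b) ×-dec E? G a b

  Edge-sym : ∀ {σ a b} → Edge σ a b → Edge σ b a
  Edge-sym (a∈ , b∈ , central , a~b) = b∈ , a∈ , Sum.swap central , Walks.E-sym G a~b

  adjᴾ : Piece → Fin n → Fin n → Bool
  adjᴾ σ a b = does (Edge? σ a b)

  module Canonical (σ : Piece) where

    vertices : List (Fin n)
    vertices = filter (Vertex? σ) (allFin n)

    m : ℕ
    m = length vertices

    embed : Fin m → Fin n
    embed = lookup vertices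

    embed-Vertex : ∀ i → Vertex σ (embed i)
    embed-Vertex i = proj₂ (Membershipₚ.∈-filter⁻ (Vertex? σ) {xs = allFin n} (∈-lookup i))

    embed-injective : ∀ {i j} → embed i ≡ embed j → i ≡ j
    embed-injective = lookup-injective (Uniqueₚ.filter⁺ (Vertex? σ) (Uniqueₚ.allFin⁺ n))

    index : ∀ {x} → Vertex σ x → Fin m
    index x∈ = Any.index (Membershipₚ.∈-filter⁺ (Vertex? σ) (∈-allFin _) x∈)

    embed-index : ∀ {x} (x∈ : Vertex σ x) → embed (index x∈) ≡ x
    embed-index x∈ = sym (Anyₚ.lookup-index (Membershipₚ.∈-filter⁺ (Vertex? σ) (∈-allFin _) x∈))

    indexOf : (mx : Maybe (Fin n)) → (∀ {x} → mx ≡ just x → Vertex σ x) → Maybe (Fin m)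
    indexOf nothing  _  = nothing
    indexOf (just x) x∈ = just (index (x∈ refl))

    map-embed-indexOf : ∀ mx (x∈ : ∀ {x} → mx ≡ just x → Vertex σ x) → Maybe.map embed (indexOf mx x∈) ≡ mx
    map-embed-indexOf nothing  _  = refl
    map-embed-indexOf (just x) x∈ = cong just (embed-index (x∈ refl))

    labelIndex : Fin k → Maybe (Fin m)
    labelIndex ℓ = indexOf (lab σ ℓ) (lab-Vertex σ)

    map-embed-labelIndex : ∀ ℓ → Maybe.map embed (labelIndex ℓ) ≡ lab σ ℓ
    map-embed-labelIndex ℓ = map-embed-indexOf (lab σ ℓ) (lab-Vertex σ)

  toLGraph : Piece → LGraph k
  toLGraph σ = record
    { graph = record
      { n      = m
      ; adj    = λ i j → adjᴾ σ (embed i) (embed j)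
      ; sym    = λ i j → does-⇔ (mk⇔ (Edge-sym {σ}) (Edge-sym {σ}))
                                 (Edge? σ (embed i) (embed j)) (Edge? σ (embed j) (embed i))
      ; irrefl = λ i → dec-false (Edge? σ (embed i) (embed i)) (λ (_ , _ , _ , e) → Walks.E-irrefl G e refl) }
    ; label = labelIndex }
    where open Canonical σ

  record Realises (H : LGraph k) (σ : Piece) : Set where
    field
      φ           : LV H → Fin n
      φ-injective : ∀ {a b} → φ a ≡ φ b → a ≡ b
      φ-Vertex    : ∀ a → Vertex σ (φ a)
      ψ           : ∀ {x} → Vertex σ x → LV H
      φ-ψ         : ∀ {x} (x∈ : Vertex σ x) → φ (ψ x∈) ≡ x
      adj-φ       : ∀ a b → Graph.adj (graph H) a b ≡ adjᴾ σ (φ a) (φ b)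
      label-φ     : ∀ ℓ → Maybe.map φ (label H ℓ) ≡ lab σ ℓ

    map-φ-injective : ∀ {a b : Maybe (LV H)} → Maybe.map φ a ≡ Maybe.map φ b → a ≡ b
    map-φ-injective {nothing} {nothing} _ = refl
    map-φ-injective {just a}  {just b}  e = cong just (φ-injective (Maybeₚ.just-injective e))

    label-ψ : ∀ {ℓ x} (x∈ : Vertex σ x) → lab σ ℓ ≡ just x → label H ℓ ≡ just (ψ x∈)
    label-ψ {ℓ} x∈ e = map-φ-injective (trans (label-φ ℓ) (trans e (cong just (sym (φ-ψ x∈)))))

    label-ψ′ : ∀ {ℓ} a → lab σ ℓ ≡ just (φ a) → label H ℓ ≡ just a
    label-ψ′ a e = trans (label-ψ (φ-Vertex a) e) (cong just (φ-injective (φ-ψ (φ-Vertex a))))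

    E-φ : ∀ {a b} → LE H a b → Edge σ (φ a) (φ b)
    E-φ {a} {b} e = from-does (Edge? σ (φ a) (φ b)) (trans (sym (adj-φ a b)) e)

    φ-E : ∀ {a b} → Edge σ (φ a) (φ b) → LE H a b
    φ-E {a} {b} e = trans (adj-φ a b) (dec-true (Edge? σ (φ a) (φ b)) e)

  canonical : ∀ σ → Realises (toLGraph σ) σ
  canonical σ = record
    { φ = embed ; φ-injective = embed-injective ; φ-Vertex = embed-Vertex ; ψ = index ; φ-ψ = embed-index
    ; adj-φ = λ _ _ → refl ; label-φ = map-embed-labelIndex }
    where open Canonical σ

  leaf-realised : ∀ {H σ} → Realises H σ → (∀ {x} → Vertex σ x → ∃ λ ℓ → lab σ ℓ ≡ just x) → CTree k H
  leaf-realised R labelled = leaf λ a → Product.map₂ (label-ψ′ a) (labelled (φ-Vertex a))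
    where open Realises R

  removal-realised : ∀ {H H₂ σ lab₂} {lab₂-Vertex : ∀ {ℓ x} → lab₂ ℓ ≡ just x → Vertex σ x} →
                     Realises H σ → Realises H₂ (relabel σ lab₂ lab₂-Vertex) → ∀ {ℓ} →
                     lab σ ℓ ≡ nothing → (∀ ℓ′ → ℓ′ ≢ ℓ → lab₂ ℓ′ ≡ lab σ ℓ′) → RemoveLabel ℓ H₂ H
  removal-realised {H} {H₂} {σ} {lab₂} R R₂ {ℓ} ℓ↦nothing same-labels =
    f , g , g∘f , f∘g , adj-f , R.map-φ-injective (trans (R.label-φ ℓ) ℓ↦nothing) , label-f
    where
    module R  = Realises R
    module R₂ = Realises R₂
    f : LV H₂ → LV H
    f a = R.ψ (R₂.φ-Vertex a)
    g : LV H → LV H₂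
    g a = R₂.ψ (R.φ-Vertex a)
    φ-f : ∀ a → R.φ (f a) ≡ R₂.φ a
    φ-f a = R.φ-ψ (R₂.φ-Vertex a)
    φ-g : ∀ a → R₂.φ (g a) ≡ R.φ a
    φ-g a = R₂.φ-ψ (R.φ-Vertex a)
    g∘f : ∀ a → g (f a) ≡ a
    g∘f a = R₂.φ-injective (trans (φ-g (f a)) (φ-f a))
    f∘g : ∀ a → f (g a) ≡ a
    f∘g a = R.φ-injective (trans (φ-f (g a)) (φ-g a))
    adj-f : ∀ a b → Graph.adj (graph H) (f a) (f b) ≡ Graph.adj (graph H₂) a b
    adj-f a b = trans (R.adj-φ (f a) (f b)) (trans (cong₂ (adjᴾ σ) (φ-f a) (φ-f b)) (sym (R₂.adj-φ a b)))
    label-f : ∀ ℓ′ → ℓ′ ≢ ℓ → label H ℓ′ ≡ Maybe.map f (label H₂ ℓ′)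
    label-f ℓ′ ℓ′≢ℓ = R.map-φ-injective (begin
      Maybe.map R.φ (label H ℓ′)                     ≡⟨ R.label-φ ℓ′ ⟩
      lab σ ℓ′                                             ≡⟨ sym (same-labels ℓ′ ℓ′≢ℓ) ⟩
      lab₂ ℓ′                                              ≡⟨ sym (R₂.label-φ ℓ′) ⟩
      Maybe.map R₂.φ (label H₂ ℓ′)                   ≡⟨ Maybeₚ.map-cong (sym ∘ φ-f) (label H₂ ℓ′) ⟩
      Maybe.map (R.φ ∘ f) (label H₂ ℓ′)              ≡⟨ Maybeₚ.map-∘ (label H₂ ℓ′) ⟩
      Maybe.map R.φ (Maybe.map f (label H₂ ℓ′)) ∎)
      where open ≡-Reasoning

  record Decomposes {m : ℕ} (σ : Piece) (σs : Fin m → Piece) : Set where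
    field
      vertex-union : ∀ {x} → Vertex σ x → ∃ λ i → Vertex (σs i) x
      vertex-sub   : ∀ i {x} → Vertex (σs i) x → Vertex σ x
      edge-union   : ∀ {a b} → Edge σ a b → ∃ λ i → Edge (σs i) a b
      edge-sub     : ∀ i {a b} → Edge (σs i) a b → Edge σ a b
      label-union  : ∀ {ℓ x} → lab σ ℓ ≡ just x → ∃ λ i → lab (σs i) ℓ ≡ just x
      label-sub    : ∀ i {ℓ x} → lab (σs i) ℓ ≡ just x → lab σ ℓ ≡ just x
      shared       : ∀ i j {x} → i ≢ j → Vertex (σs i) x → Vertex (σs j) x →
                     ∃ λ ℓ → lab (σs i) ℓ ≡ just x × lab (σs j) ℓ ≡ just x

  product-realised : ∀ {H σ m} {σs : Fin m → Piece} → Realises H σ → Decomposes σ σs → IsProduct (toLGraph ∘ σs) H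
  product-realised {H} {σ} {m} {σs} R D = ι , surjective , identifies , edges , labels
    where
    open Decomposes D
    module R = Realises R
    module Rᵢ (i : Fin m) = Realises (canonical (σs i))
    Gs : Fin m → LGraph k
    Gs = toLGraph ∘ σs

    ι : (i : Fin m) → LV (Gs i) → LV H
    ι i u = R.ψ (vertex-sub i (Rᵢ.φ-Vertex i u))

    φ-ι : ∀ i u → R.φ (ι i u) ≡ Rᵢ.φ i u
    φ-ι i u = R.φ-ψ _

    ι-ψ : ∀ {i a} (x∈ : Vertex (σs i) (R.φ a)) → ι i (Rᵢ.ψ i x∈) ≡ a
    ι-ψ {i} x∈ = R.φ-injective (trans (φ-ι i _) (Rᵢ.φ-ψ i x∈))

    surjective : ∀ a → ∃₂ λ i u → ι i u ≡ a
    surjective a = let (i , x∈) = vertex-union (R.φ-Vertex a) in i , Rᵢ.ψ i x∈ , ι-ψ x∈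

    ShareLabel⇒same : ∀ {p q} → ShareLabel Gs p q → Rᵢ.φ (proj₁ p) (proj₂ p) ≡ Rᵢ.φ (proj₁ q) (proj₂ q)
    ShareLabel⇒same {i , u} {j , w} (ℓ , ℓ↦u , ℓ↦w) = Maybeₚ.just-injective
      (trans (sym (label-sub i (trans (sym (Rᵢ.label-φ i ℓ)) (cong (Maybe.map (Rᵢ.φ i)) ℓ↦u))))
             (label-sub j (trans (sym (Rᵢ.label-φ j ℓ)) (cong (Maybe.map (Rᵢ.φ j)) ℓ↦w))))

    EqClosure⇒same : ∀ {p q} → EqClosure (ShareLabel Gs) p q → Rᵢ.φ (proj₁ p) (proj₂ p) ≡ Rᵢ.φ (proj₁ q) (proj₂ q)
    EqClosure⇒same ε               = refl
    EqClosure⇒same (fwd p→z ◅ z~q) = trans (ShareLabel⇒same p→z) (EqClosure⇒same z~q)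
    EqClosure⇒same (bwd z→p ◅ z~q) = trans (sym (ShareLabel⇒same z→p)) (EqClosure⇒same z~q)

    identifies : ∀ i u j w → (ι i u ≡ ι j w) ⇔ EqClosure (ShareLabel Gs) (i , u) (j , w)
    identifies i u j w = mk⇔ to (λ q → R.φ-injective (trans (φ-ι i u) (trans (EqClosure⇒same q) (sym (φ-ι j w)))))
      where
      to : ι i u ≡ ι j w → EqClosure (ShareLabel Gs) (i , u) (j , w)
      to ιu≡ιw with trans (sym (φ-ι i u)) (trans (cong R.φ ιu≡ιw) (φ-ι j w)) | i Fin.≟ j
      ... | same | yes refl rewrite Rᵢ.φ-injective i same = ε
      ... | same | no i≢j with shared i j i≢j (Rᵢ.φ-Vertex i u) (subst (Vertex (σs j)) (sym same) (Rᵢ.φ-Vertex j w))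
      ...   | ℓ , ℓ↦u , ℓ↦w = fwd (ℓ , Rᵢ.label-ψ′ i u ℓ↦u , Rᵢ.label-ψ′ j w (trans ℓ↦w (cong just same))) ◅ ε

    edges : ∀ a b → LE H a b ⇔ (∃ λ i → ∃₂ λ u v → LE (Gs i) u v × ι i u ≡ a × ι i v ≡ b)
    edges a b = mk⇔ to from
      where
      to : LE H a b → ∃ λ i → ∃₂ λ u v → LE (Gs i) u v × ι i u ≡ a × ι i v ≡ b
      to e with edge-union (R.E-φ e)
      ... | i , edge@(a∈ , b∈ , _) = i , Rᵢ.ψ i a∈ , Rᵢ.ψ i b∈ ,
            Rᵢ.φ-E i (subst₂ (Edge (σs i)) (sym (Rᵢ.φ-ψ i a∈)) (sym (Rᵢ.φ-ψ i b∈)) edge) , ι-ψ a∈ , ι-ψ b∈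
      from : (∃ λ i → ∃₂ λ u v → LE (Gs i) u v × ι i u ≡ a × ι i v ≡ b) → LE H a b
      from (i , u , v , e , refl , refl) =
        R.φ-E (subst₂ (Edge σ) (sym (φ-ι i u)) (sym (φ-ι i v)) (edge-sub i (Rᵢ.E-φ i e)))

    labels : ∀ ℓ a → (label H ℓ ≡ just a) ⇔ (∃₂ λ i u → label (Gs i) ℓ ≡ just u × ι i u ≡ a)
    labels ℓ a = mk⇔ to from
      where
      to : label H ℓ ≡ just a → ∃₂ λ i u → label (Gs i) ℓ ≡ just u × ι i u ≡ a
      to e with label-union (trans (sym (R.label-φ ℓ)) (cong (Maybe.map R.φ) e))
      ... | i , ℓ↦a = i , Rᵢ.ψ i (lab-Vertex (σs i) ℓ↦a) , Rᵢ.label-ψ i _ ℓ↦a , ι-ψ _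
      from : (∃₂ λ i u → label (Gs i) ℓ ≡ just u × ι i u ≡ a) → label H ℓ ≡ just a
      from (i , u , ℓ↦u , refl) = R.map-φ-injective (begin
        Maybe.map R.φ (label H ℓ)  ≡⟨ R.label-φ ℓ ⟩
        lab σ ℓ                          ≡⟨ label-sub i (trans (sym (Rᵢ.label-φ i ℓ)) (cong (Maybe.map (Rᵢ.φ i)) ℓ↦u)) ⟩
        just (Rᵢ.φ i u)                  ≡⟨ cong just (sym (φ-ι i u)) ⟩
        just (R.φ (ι i u))               ∎)
        where open ≡-Reasoning

-- Pebble forest covers yield construction trees

-- For each vertex v we build the piece spanned by the subtree of v and its boundary, labelled
-- by pebbles: glue the star of v to the pieces of its children, then eliminate the pebble of v.
-- The pebbling condition makes the pebbles of a boundary distinct, so gluing along labels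
-- identifies exactly the right vertices.
module FromPebbleForestCover {k q : ℕ} {G : Graph} (P : PebbleForestCover k G) (depth≤ : ForestDepthAtMost P q) where

  open PebbleForestCover P
  open Forest parent
  open Pieces G k
  open Walks G using (E-sym; E-irrefl)

  rootDist : ∀ v → RootDist parent v (proj₁ (isForest v))
  rootDist v = proj₂ (isForest v)

  infix 4 _⪯_ _⪯?_
  _⪯_ : V G → V G → Set
  _⪯_ = Anc parent

  _⪯?_ : ∀ u v → Dec (u ⪯ v)
  u ⪯? v = Anc? (rootDist v) u

  parent≢self : ∀ {c} → parent c ≢ just c
  parent≢self {c} e = ℕₚ.<-irrefl refl (RootDist-parent< (rootDist c) e (rootDist c))

  StrictBoundary : V G → V G → Set
  StrictBoundary v x = x ⪯ v × x ≢ v × ∃ λ w → v ⪯ w × E G x w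

  StrictBoundary? : ∀ v x → Dec (StrictBoundary v x)
  StrictBoundary? v x = (x ⪯? v) ×-dec ¬? (x Fin.≟ v) ×-dec any? (λ w → (v ⪯? w) ×-dec E? G x w)

  ClosedBoundary : V G → V G → Set
  ClosedBoundary v x = x ≡ v ⊎ StrictBoundary v x

  ClosedBoundary? : ∀ v x → Dec (ClosedBoundary v x)
  ClosedBoundary? v x = (x Fin.≟ v) ⊎-dec StrictBoundary? v x

  Region : V G → V G → Set
  Region v x = v ⪯ x ⊎ StrictBoundary v x

  Region? : ∀ v x → Dec (Region v x)
  Region? v x = (v ⪯? x) ⊎-dec StrictBoundary? v x

  pebbles-differ : ∀ {x y w} → E G x w → x ⪯ y → x ≢ y → y ⪯ w → pebble x ≢ pebble y
  pebbles-differ {x} {y} {w} x~w x⪯y x≢y y⪯w = pebbling x w y x~w (Anc-trans x⪯y y⪯w) x≢w x⪯y x≢y y⪯w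
    where
    x≢w : x ≢ w
    x≢w refl = x≢y (Anc-antisym (rootDist y) x⪯y y⪯w)

  pebble-injective : ∀ v {x y} → ClosedBoundary v x → ClosedBoundary v y → pebble x ≡ pebble y → x ≡ y
  pebble-injective v (inj₁ refl) (inj₁ refl) _ = refl
  pebble-injective v (inj₁ refl) (inj₂ (y⪯v , y≢v , w , v⪯w , y~w)) same =
    ⊥-elim (pebbles-differ y~w y⪯v y≢v v⪯w (sym same))
  pebble-injective v (inj₂ (x⪯v , x≢v , w , v⪯w , x~w)) (inj₁ refl) same =
    ⊥-elim (pebbles-differ x~w x⪯v x≢v v⪯w same)
  pebble-injective v {x} {y} (inj₂ (x⪯v , _ , w , v⪯w , x~w)) (inj₂ (y⪯v , _ , w′ , v⪯w′ , y~w′)) same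
    with x Fin.≟ y
  ... | yes x≡y = x≡y
  ... | no x≢y with Anc-linear x⪯v y⪯v
  ...   | inj₁ x⪯y = ⊥-elim (pebbles-differ x~w x⪯y x≢y (Anc-trans y⪯v v⪯w) same)
  ...   | inj₂ y⪯x = ⊥-elim (pebbles-differ y~w′ y⪯x (x≢y ∘ sym) (Anc-trans x⪯v v⪯w′) (sym same))

  pebbleLabel : {B : V G → Set} → Decidable B → Fin k → Maybe (V G)
  pebbleLabel B? ℓ with any? (λ x → B? x ×-dec (pebble x Fin.≟ ℓ))
  ... | yes (x , _) = just x
  ... | no _        = nothing

  pebbleLabel-sound : ∀ {B} (B? : Decidable B) {ℓ x} → pebbleLabel B? ℓ ≡ just x → B x × pebble x ≡ ℓ
  pebbleLabel-sound B? {ℓ} e with any? (λ x → B? x ×-dec (pebble x Fin.≟ ℓ))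
  pebbleLabel-sound B? refl | yes (_ , found) = found

  pebbleLabel-hit : ∀ {B} (B? : Decidable B) {x} → B x → (∀ {y} → B y → pebble y ≡ pebble x → y ≡ x) →
                    pebbleLabel B? (pebble x) ≡ just x
  pebbleLabel-hit B? {x} Bx unique with any? (λ y → B? y ×-dec (pebble y Fin.≟ pebble x))
  ... | yes (y , By , same) = cong just (unique By same)
  ... | no none             = ⊥-elim (none (x , Bx , refl))

  pebbleLabel-miss : ∀ {B} (B? : Decidable B) {ℓ} → (∀ {y} → B y → pebble y ≢ ℓ) → pebbleLabel B? ℓ ≡ nothing
  pebbleLabel-miss B? {ℓ} absent with any? (λ y → B? y ×-dec (pebble y Fin.≟ ℓ))
  ... | yes (y , By , same) = ⊥-elim (absent By same)
  ... | no _                = refl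

  closedLabel strictLabel : V G → Fin k → Maybe (V G)
  closedLabel v = pebbleLabel (ClosedBoundary? v)
  strictLabel v = pebbleLabel (StrictBoundary? v)

  closedLabel-hit : ∀ v {x} → ClosedBoundary v x → closedLabel v (pebble x) ≡ just x
  closedLabel-hit v x∈ = pebbleLabel-hit (ClosedBoundary? v) x∈ (λ y∈ same → pebble-injective v y∈ x∈ same)

  strictLabel-hit : ∀ v {x} → StrictBoundary v x → strictLabel v (pebble x) ≡ just x
  strictLabel-hit v x∈ = pebbleLabel-hit (StrictBoundary? v) x∈ (λ y∈ same → pebble-injective v (inj₂ y∈) (inj₂ x∈) same)

  strictLabel-self : ∀ v → strictLabel v (pebble v) ≡ nothing
  strictLabel-self v = pebbleLabel-miss (StrictBoundary? v)
    (λ y∈ same → proj₁ (proj₂ y∈) (pebble-injective v (inj₂ y∈) (inj₁ refl) same))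

  closedLabel-other : ∀ v ℓ → ℓ ≢ pebble v → closedLabel v ℓ ≡ strictLabel v ℓ
  closedLabel-other v ℓ ℓ≢ with strictLabel v ℓ in eq
  ... | just x = let (x∈ , pebble≡ℓ) = pebbleLabel-sound (StrictBoundary? v) eq in
                 subst (λ ℓ → closedLabel v ℓ ≡ just x) pebble≡ℓ (closedLabel-hit v (inj₂ x∈))
  ... | nothing = pebbleLabel-miss (ClosedBoundary? v) absent
    where
    absent : ∀ {y} → ClosedBoundary v y → pebble y ≢ ℓ
    absent (inj₁ refl) same = ℓ≢ (sym same)
    absent (inj₂ y∈)   same =
      just≢nothing (trans (sym (subst (λ ℓ → strictLabel v ℓ ≡ just _) same (strictLabel-hit v y∈))) eq)

  star : V G → Piece
  star v = record
    { Vertex = ClosedBoundary v ; Vertex? = ClosedBoundary? v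
    ; Centre = _≡ v ; Centre? = λ x → x Fin.≟ v
    ; lab = closedLabel v ; lab-Vertex = λ e → proj₁ (pebbleLabel-sound (ClosedBoundary? v) e) }

  below : V G → Piece
  below v = record
    { Vertex = Region v ; Vertex? = Region? v
    ; Centre = v ⪯_ ; Centre? = v ⪯?_
    ; lab = strictLabel v ; lab-Vertex = λ e → inj₂ (proj₁ (pebbleLabel-sound (StrictBoundary? v) e)) }

  Closed⇒Region : ∀ {v x} → ClosedBoundary v x → Region v x
  Closed⇒Region (inj₁ refl) = inj₁ here
  Closed⇒Region (inj₂ x∈)   = inj₂ x∈

  below⁺ : V G → Piece
  below⁺ v = relabel (below v) (closedLabel v)
    (λ e → Closed⇒Region (proj₁ (pebbleLabel-sound (ClosedBoundary? v) e)))

  ∅ᴾ : Piece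
  ∅ᴾ = record
    { Vertex = λ _ → ⊥ ; Vertex? = λ _ → no id
    ; Centre = λ _ → ⊥ ; Centre? = λ _ → no id
    ; lab = λ _ → nothing ; lab-Vertex = λ () }

  child-above : ∀ {v x} → v ⪯ x → x ≢ v → ∃ λ c → parent c ≡ just v × c ⪯ x
  child-above here         x≢v = ⊥-elim (x≢v refl)
  child-above {v} {x} (up {w = w} e v⪯w) x≢v with w Fin.≟ v
  ... | yes refl = x , e , here
  ... | no w≢v   = Product.map₂ (Product.map₂ (up e)) (child-above v⪯w w≢v)

  siblings-incomparable : ∀ {v c c′} → parent c ≡ just v → parent c′ ≡ just v → c ⪯ c′ → c ≡ c′
  siblings-incomparable {v} {c} {c′} c→v c′→v c⪯c′ with c Fin.≟ c′
  ... | yes c≡c′ = c≡c′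
  ... | no c≢c′  = ⊥-elim (parent≢self (subst (λ z → parent c ≡ just z)
                      (Anc-antisym (rootDist c) (up c→v here) (Anc-parent c⪯c′ c≢c′ c′→v)) c→v))

  child-boundary : ∀ {v c x} → parent c ≡ just v → StrictBoundary c x → ClosedBoundary v x
  child-boundary {v} {c} {x} c→v (x⪯c , x≢c , w , c⪯w , x~w) with x Fin.≟ v
  ... | yes x≡v = inj₁ x≡v
  ... | no x≢v  = inj₂ (Anc-parent x⪯c x≢c c→v , x≢v , w , Anc-trans (up c→v here) c⪯w , x~w)

  boundary-not-below-child : ∀ {v c x} → ClosedBoundary v x → parent c ≡ just v → ¬ c ⪯ x
  boundary-not-below-child {v} {c} x∈ c→v c⪯x = parent≢self (subst (λ z → parent c ≡ just z)
    (Anc-antisym (rootDist c) (up c→v here) (Anc-trans c⪯x (x⪯v x∈))) c→v)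
    where
    x⪯v : ∀ {x} → ClosedBoundary v x → x ⪯ v
    x⪯v (inj₁ refl)       = here
    x⪯v (inj₂ (x⪯v , _)) = x⪯v

  boundary-in-child : ∀ {v c x} → ClosedBoundary v x → parent c ≡ just v → Region c x → StrictBoundary c x
  boundary-in-child x∈ c→v (inj₁ c⪯x) = ⊥-elim (boundary-not-below-child x∈ c→v c⪯x)
  boundary-in-child _  _   (inj₂ x∈)  = x∈

  shared-by-siblings : ∀ {v c c′ x} → parent c ≡ just v → parent c′ ≡ just v → c ≢ c′ →
                       Region c x → Region c′ x → StrictBoundary c x
  shared-by-siblings _   _    _     (inj₂ x∈)  _            = x∈
  shared-by-siblings c→v c′→v c≢c′ (inj₁ c⪯x) (inj₂ x∈′) =
    ⊥-elim (boundary-not-below-child (child-boundary c′→v x∈′) c→v c⪯x)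
  shared-by-siblings c→v c′→v c≢c′ (inj₁ c⪯x) (inj₁ c′⪯x) with Anc-linear c⪯x c′⪯x
  ... | inj₁ c⪯c′ = ⊥-elim (c≢c′ (siblings-incomparable c→v c′→v c⪯c′))
  ... | inj₂ c′⪯c = ⊥-elim (c≢c′ (sym (siblings-incomparable c′→v c→v c′⪯c)))

  Region-edge : ∀ {c a b} → c ⪯ a → E G a b → Region c b
  Region-edge {c} {a} {b} c⪯a a~b with edgeAnc a b a~b
  ... | inj₁ a⪯b = inj₁ (Anc-trans c⪯a a⪯b)
  ... | inj₂ b⪯a with Anc-linear c⪯a b⪯a
  ...   | inj₁ c⪯b = inj₁ c⪯b
  ...   | inj₂ b⪯c with b Fin.≟ c
  ...     | yes refl = inj₁ here
  ...     | no b≢c   = inj₂ (b⪯c , b≢c , a , c⪯a , E-sym a~b)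

  whole : Piece
  whole = record
    { Vertex = λ _ → ⊤ ; Vertex? = λ _ → yes tt
    ; Centre = λ _ → ⊤ ; Centre? = λ _ → yes tt
    ; lab = λ _ → nothing ; lab-Vertex = λ () }

  whole-realised : Realises (unlabelled G) whole
  whole-realised = record
    { φ = id ; φ-injective = id ; φ-Vertex = _ ; ψ = λ {x} _ → x ; φ-ψ = λ _ → refl
    ; adj-φ = adj-φ ; label-φ = λ _ → refl }
    where
    adj-φ : ∀ a b → Graph.adj G a b ≡ adjᴾ whole a b
    adj-φ a b with Graph.adj G a b
    ... | true  = refl
    ... | false = refl

  guarded : ∀ {A : Set} → Dec A → Piece → Piece
  guarded (yes _) σ = σ
  guarded (no _)  _ = ∅ᴾ

  guarded⁺ : ∀ {A σ} (d : Dec A) (Q : Piece → Set) → A → Q σ → Q (guarded d σ)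
  guarded⁺ (yes _) _ _ q = q
  guarded⁺ (no ¬a) _ a _ = ⊥-elim (¬a a)

  guarded⁻ : ∀ {A σ} (d : Dec A) (Q : Piece → Set) → ¬ Q ∅ᴾ → Q (guarded d σ) → A × Q σ
  guarded⁻ (yes a) _ _    q = a , q
  guarded⁻ (no _)  _ ¬Q∅ q = ⊥-elim (¬Q∅ q)

  -- Factor 1 is empty, so that every product has at least two factors.
  factors : ∀ {A : V G → Set} → Piece → (∀ c → Dec (A c)) → Fin (2 + n) → Piece
  factors σ₀ _  zero          = σ₀
  factors _  _  (suc zero)    = ∅ᴾ
  factors _  A? (suc (suc c)) = guarded (A? c) (below c)

  child? : ∀ v c → Dec (parent c ≡ just v)
  child? v c = Maybeₚ.≡-dec Fin._≟_ (parent c) (just v)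

  root? : ∀ c → Dec (parent c ≡ nothing)
  root? c = Maybeₚ.≡-dec Fin._≟_ (parent c) nothing

  below⁺-decomposes : ∀ v → Decomposes (below⁺ v) (factors (star v) (child? v))
  below⁺-decomposes v = record
    { vertex-union = vertex-union
    ; vertex-sub   = vertex-sub
    ; edge-union   = edge-union
    ; edge-sub     = edge-sub
    ; label-union  = λ e → zero , e
    ; label-sub    = label-sub
    ; shared       = shared }
    where
    σs : Fin (2 + n) → Piece
    σs = factors (star v) (child? v)

    in-child : ∀ {c} (Q : Piece → Set) → parent c ≡ just v → Q (below c) → Q (σs (suc (suc c)))
    in-child {c} Q c→v = guarded⁺ (child? v c) Q c→v

    from-child : ∀ {c} (Q : Piece → Set) → ¬ Q ∅ᴾ → Q (σs (suc (suc c))) → parent c ≡ just v × Q (below c)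
    from-child {c} = guarded⁻ (child? v c)

    vertex-union : ∀ {x} → Region v x → ∃ λ i → Vertex (σs i) x
    vertex-union (inj₂ x∈) = zero , inj₂ x∈
    vertex-union {x} (inj₁ v⪯x) with x Fin.≟ v
    ... | yes refl = zero , inj₁ refl
    ... | no x≢v   = let (c , c→v , c⪯x) = child-above v⪯x x≢v in
                     suc (suc c) , in-child (λ τ → Vertex τ x) c→v (inj₁ c⪯x)

    vertex-sub : ∀ i {x} → Vertex (σs i) x → Region v x
    vertex-sub zero          x∈ = Closed⇒Region x∈
    vertex-sub (suc (suc c)) x∈ with from-child (λ τ → Vertex τ _) (λ ()) x∈
    ... | c→v , inj₁ c⪯x = inj₁ (Anc-trans (up c→v here) c⪯x)
    ... | c→v , inj₂ x∈′ = Closed⇒Region (child-boundary c→v x∈′)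

    centre-sub : ∀ i {x} → Centre (σs i) x → v ⪯ x
    centre-sub zero          refl    = here
    centre-sub (suc (suc c)) central with from-child (λ τ → Centre τ _) (λ ()) central
    ... | c→v , c⪯x = Anc-trans (up c→v here) c⪯x

    edge-sub : ∀ i {a b} → Edge (σs i) a b → Edge (below⁺ v) a b
    edge-sub i (a∈ , b∈ , central , a~b) =
      vertex-sub i a∈ , vertex-sub i b∈ , Sum.map (centre-sub i) (centre-sub i) central , a~b

    edge-from : ∀ {a b} → v ⪯ a → E G a b → ∃ λ i → Edge (σs i) a b
    edge-from {a} {b} v⪯a a~b with a Fin.≟ v
    edge-from {a} {b} v⪯a a~b | no a≢v with child-above v⪯a a≢v
    ... | c , c→v , c⪯a =
      suc (suc c) , in-child (λ τ → Edge τ a b) c→v (inj₁ c⪯a , Region-edge c⪯a a~b , inj₁ c⪯a , a~b)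
    edge-from {a} {b} v⪯a a~b | yes refl with edgeAnc a b a~b
    ... | inj₂ b⪯a = zero , inj₁ refl , inj₂ (b⪯a , E-irrefl a~b ∘ sym , a , here , E-sym a~b) , inj₁ refl , a~b
    ... | inj₁ a⪯b with child-above a⪯b (E-irrefl a~b ∘ sym)
    ...   | c , c→a , c⪯b = suc (suc c) , in-child (λ τ → Edge τ a b) c→a
            (inj₂ (up c→a here , (λ a≡c → parent≢self (subst (λ z → parent c ≡ just z) a≡c c→a)) , b , c⪯b , a~b) ,
             inj₁ c⪯b , inj₂ c⪯b , a~b)

    edge-union : ∀ {a b} → Edge (below⁺ v) a b → ∃ λ i → Edge (σs i) a b
    edge-union (_ , _ , inj₁ v⪯a , a~b) = edge-from v⪯a a~b
    edge-union (_ , _ , inj₂ v⪯b , a~b) = let (i , e) = edge-from v⪯b (E-sym a~b) in i , Edge-sym {σs i} e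

    label-sub : ∀ i {ℓ x} → lab (σs i) ℓ ≡ just x → closedLabel v ℓ ≡ just x
    label-sub zero          e = e
    label-sub (suc (suc c)) e with from-child (λ τ → lab τ _ ≡ just _) (λ ()) e
    ... | c→v , e′ with pebbleLabel-sound (StrictBoundary? c) e′
    ...   | x∈ , refl = closedLabel-hit v (child-boundary c→v x∈)

    shared : ∀ i j {x} → i ≢ j → Vertex (σs i) x → Vertex (σs j) x →
             ∃ λ ℓ → lab (σs i) ℓ ≡ just x × lab (σs j) ℓ ≡ just x
    shared zero zero i≢j _ _ = ⊥-elim (i≢j refl)
    shared zero (suc (suc c)) {x} _ x∈ y∈ with from-child (λ τ → Vertex τ x) (λ ()) y∈
    ... | c→v , r = pebble x , closedLabel-hit v x∈ ,
                    in-child (λ τ → lab τ (pebble x) ≡ just x) c→v (strictLabel-hit c (boundary-in-child x∈ c→v r))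
    shared (suc (suc c)) zero {x} _ y∈ x∈ with from-child (λ τ → Vertex τ x) (λ ()) y∈
    ... | c→v , r = pebble x ,
                    in-child (λ τ → lab τ (pebble x) ≡ just x) c→v (strictLabel-hit c (boundary-in-child x∈ c→v r)) ,
                    closedLabel-hit v x∈
    shared (suc (suc c)) (suc (suc c′)) {x} i≢j x∈ x∈′
      with from-child (λ τ → Vertex τ x) (λ ()) x∈ | from-child (λ τ → Vertex τ x) (λ ()) x∈′
    ... | c→v , r | c′→v , r′ = pebble x ,
          in-child (λ τ → lab τ (pebble x) ≡ just x) c→v (strictLabel-hit c (shared-by-siblings c→v c′→v c≢c′ r r′)) ,
          in-child (λ τ → lab τ (pebble x) ≡ just x) c′→v (strictLabel-hit c′ (shared-by-siblings c′→v c→v (c≢c′ ∘ sym) r′ r))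
      where
      c≢c′ : c ≢ c′
      c≢c′ c≡c′ = i≢j (cong (Fin.suc ∘ Fin.suc) c≡c′)

  root-above : ∀ x → ∃ λ r → parent r ≡ nothing × r ⪯ x
  root-above x = go (rootDist x)
    where
    go : ∀ {y m} → RootDist parent y m → ∃ λ r → parent r ≡ nothing × r ⪯ y
    go {y} (root e) = y , e , here
    go (step e d)   = Product.map₂ (Product.map₂ (up e)) (go d)

  root-no-boundary : ∀ {r x} → parent r ≡ nothing → ¬ StrictBoundary r x
  root-no-boundary r-root (x⪯r , x≢r , _) = x≢r (Anc-root x⪯r r-root)

  whole-decomposes : Decomposes whole (factors ∅ᴾ root?)
  whole-decomposes = record
    { vertex-union = λ {x} _ → let (r , r-root , r⪯x) = root-above x in
                       suc (suc r) , guarded⁺ (root? r) (λ τ → Vertex τ x) r-root (inj₁ r⪯x)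
    ; vertex-sub   = λ _ _ → tt
    ; edge-union   = λ { {a} {b} (_ , _ , _ , a~b) → let (r , r-root , r⪯a) = root-above a in
                       suc (suc r) , guarded⁺ (root? r) (λ τ → Edge τ a b) r-root
                                       (inj₁ r⪯a , Region-edge r⪯a a~b , inj₁ r⪯a , a~b) }
    ; edge-sub     = λ _ (_ , _ , _ , a~b) → tt , tt , inj₁ tt , a~b
    ; label-union  = λ ()
    ; label-sub    = label-sub
    ; shared       = shared }
    where
    σs : Fin (2 + n) → Piece
    σs = factors ∅ᴾ root?

    label-sub : ∀ i {ℓ x} → lab (σs i) ℓ ≡ just x → nothing ≡ just x
    label-sub (suc (suc r)) e with guarded⁻ (root? r) (λ τ → lab τ _ ≡ just _) (λ ()) e
    ... | r-root , e′ = ⊥-elim (root-no-boundary r-root (proj₁ (pebbleLabel-sound (StrictBoundary? r) e′)))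

    below-root : ∀ {r x} → Vertex (σs (suc (suc r))) x → parent r ≡ nothing × r ⪯ x
    below-root {r} x∈ with guarded⁻ (root? r) (λ τ → Vertex τ _) (λ ()) x∈
    ... | r-root , inj₁ r⪯x = r-root , r⪯x
    ... | r-root , inj₂ x∈′ = ⊥-elim (root-no-boundary r-root x∈′)

    shared : ∀ i j {x} → i ≢ j → Vertex (σs i) x → Vertex (σs j) x →
             ∃ λ ℓ → lab (σs i) ℓ ≡ just x × lab (σs j) ℓ ≡ just x
    shared (suc (suc r)) (suc (suc r′)) i≢j x∈ x∈′ with below-root x∈ | below-root x∈′
    ... | r-root , r⪯x | r′-root , r′⪯x =
      ⊥-elim (i≢j (cong (Fin.suc ∘ Fin.suc) (Sum.[ r≡r′ , sym ∘ r′≡r ]′ (Anc-linear r⪯x r′⪯x))))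
      where
      r≡r′ : r ⪯ r′ → r ≡ r′
      r≡r′ r⪯r′ = Anc-root r⪯r′ r′-root
      r′≡r : r′ ⪯ r → r′ ≡ r
      r′≡r r′⪯r = Anc-root r′⪯r r-root

  BoundedTree : Piece → ℕ → Set
  BoundedTree σ f = Σ (CTree k (toLGraph σ)) λ t → elimDepth t ≤ f

  emptyTree : ∀ {f} → BoundedTree ∅ᴾ f
  emptyTree = leaf-realised (canonical ∅ᴾ) (λ ()) , z≤n

  starTree : ∀ v {f} → BoundedTree (star v) f
  starTree v = leaf-realised (canonical (star v)) (λ x∈ → pebble _ , closedLabel-hit v x∈) , z≤n

  productTree : ∀ {H σ σ₀ f} {A : V G → Set} (A? : ∀ c → Dec (A c)) → Realises H σ → Decomposes σ (factors σ₀ A?) →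
                BoundedTree σ₀ f → (∀ c → A c → BoundedTree (below c) f) → Σ (CTree k H) λ t → elimDepth t ≤ f
  productTree {σ₀ = σ₀} {f} A? R D t₀ ts =
    prod (2 + n) (s≤s (s≤s z≤n)) (toLGraph ∘ factors σ₀ A?) (proj₁ ∘ trees) (product-realised R D) ,
    maxF-least (2 + n) (elimDepth ∘ proj₁ ∘ trees) (proj₂ ∘ trees)
    where
    guardedTree : ∀ {B σ} (d : Dec B) → (B → BoundedTree σ f) → BoundedTree (guarded d σ) f
    guardedTree (yes b) t = t b
    guardedTree (no _)  _ = emptyTree
    trees : ∀ i → BoundedTree (factors σ₀ A? i) f
    trees zero          = t₀
    trees (suc zero)    = emptyTree
    trees (suc (suc c)) = guardedTree (A? c) (ts c)

  -- A vertex at depth m gets a subtree of elimination depth q + 1 - m.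
  belowTree : ∀ f v {m} → RootDist parent v m → m + f ≡ suc q → BoundedTree (below v) f
  belowTree zero v {m} d m+0≡1+q =
    ⊥-elim (ℕₚ.1+n≰n (subst (_≤ q) (trans (sym (ℕₚ.+-identityʳ m)) m+0≡1+q) (depth≤ v m d)))
  belowTree (suc f) v {m} d m+1+f≡1+q =
    elim (toLGraph (below⁺ v)) (pebble v) (proj₁ product) removal , s≤s (proj₂ product)
    where
    product : Σ (CTree k (toLGraph (below⁺ v))) λ t → elimDepth t ≤ f
    product = productTree (child? v) (canonical (below⁺ v)) (below⁺-decomposes v) (starTree v)
                (λ c c→v → belowTree f c (step c→v d) (trans (sym (ℕₚ.+-suc m f)) m+1+f≡1+q))
    removal : RemoveLabel (pebble v) (toLGraph (below⁺ v)) (toLGraph (below v))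
    removal = removal-realised (canonical (below v)) (canonical (below⁺ v)) (strictLabel-self v) (closedLabel-other v)

  constructionTree : HasConstructionTree k q G
  constructionTree = productTree root? whole-realised whole-decomposes emptyTree
                       (λ r r-root → belowTree q r (root r-root) refl)

pebbleForestCover⇒constructionTree : ∀ {k q G} → HasPebbleForestCover k q G → HasConstructionTree k q G
pebbleForestCover⇒constructionTree (P , depth≤) = FromPebbleForestCover.constructionTree P depth≤

theorem3p4 : (k q : ℕ) → 1 ≤ k → 1 ≤ q → (G : Graph) →
    (HasConstructionTree k q G ⇔ HasTreeDecomposition k q G) ×
    (HasTreeDecomposition k q G ⇔ HasPebbleForestCover k q G)
theorem3p4 k q k≥1 _ G =
  mk⇔ (slotForestCover⇒treeDecomposition ∘ constructionTree⇒slotForestCover)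
      (pebbleForestCover⇒constructionTree ∘ slotForestCover⇒pebbleForestCover ∘ treeDecomposition⇒slotForestCover k≥1) ,
  mk⇔ (slotForestCover⇒pebbleForestCover ∘ treeDecomposition⇒slotForestCover k≥1)
      (slotForestCover⇒treeDecomposition ∘ constructionTree⇒slotForestCover ∘ pebbleForestCover⇒constructionTree)
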